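{- Let $n \geq 8$ be even and let $G_0=(V,E)$ be a graph on $n$ vertices. Suppose there are vertices $w_1,w_2,w_3,w_4 \in V$ such that $G_0[\{w_1,w_2,w_3\}] \cong K_3$, $d_{G_0}(w_1)=d_{G_0}(w_2)=d_{G_0}(w_3)=2$, $d_{G_0}(w_4)=0$, and $G_0\setminus\{w_1,w_2,w_3,w_4\}$ has a Hamilton cycle. If Max is the second player, then $s(G_0,\mathcal{PM}) \geq \binom{n-4}{2}$.
   Context: $\mathcal{PM}$ is the property of admitting a perfect matching. For a graph $H$ on $n$ vertices not in $\mathcal{PM}$, the saturation game $(H,\mathcal{PM})$ is played as follows. Starting with $G=H$, two players, Mini and Max, alternately add to $G$ an edge $e \notin E(G)$ such that $G\cup\{e\}$ has no perfect matching. The game ends when no such edge exists. Max wants to maximize and Mini to minimize the final number of edges. The score $s(H,\mathcal{PM})$ is the number of edges of the final graph under optimal play. $G_0\setminus S$ denotes the graph obtained by deleting the vertex set $S$. -}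

module Defs where

open import Data.Nat using (ℕ; zero; suc; _≤_; _<ᵇ_)
open import Data.Fin using (Fin; zero; suc; toℕ; inject₁; fromℕ; _≟_)
open import Data.Bool using (Bool; true; false; _∧_; _∨_; not)
open import Data.Bool.Properties using (∧-comm; ∨-comm)
open import Data.List using (List; length; filterᵇ; allFin; cartesianProduct)
open import Data.Product using (Σ; ∃; _×_; _,_)
open import Data.Sum using (_⊎_)
open import Relation.Nullary using (¬_; yes; no)
open import Relation.Nullary.Decidable using (⌊_⌋)
open import Relation.Binary.PropositionalEquality using (_≡_; _≢_; refl; sym; cong)
open import Function using (_⇔_)

record Graph (n : ℕ) : Set where
  field
    adj    : Fin n → Fin n → Bool
    adjSym : ∀ u v → adj u v ≡ adj v u
    adjIrr : ∀ u → adj u u ≡ false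
open Graph public

Adj : ∀ {n} → Graph n → Fin n → Fin n → Set
Adj G u v = adj G u v ≡ true

_==_ : ∀ {n} → Fin n → Fin n → Bool
x == y = ⌊ x ≟ y ⌋

==-sym : ∀ {n} (x y : Fin n) → (x == y) ≡ (y == x)
==-sym x y with x ≟ y | y ≟ x
... | yes _ | yes _ = refl
... | no _  | no _  = refl
... | yes p | no q  = Data.Empty.⊥-elim (q (sym p)) where import Data.Empty
... | no p  | yes q = Data.Empty.⊥-elim (p (sym q)) where import Data.Empty

==-refl : ∀ {n} (x : Fin n) → (x == x) ≡ true
==-refl x with x ≟ x
... | yes _ = refl
... | no p  = Data.Empty.⊥-elim (p refl) where import Data.Empty

-- G + uv : the graph obtained by adding the edge {u,v} (a no-op when u = v)
addEdge : ∀ {n} → Graph n → Fin n → Fin n → Graph n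
addEdge {n} G u v = record { adj = a ; adjSym = s ; adjIrr = i }
  where
  new : Fin n → Fin n → Bool
  new x y = (x == u ∧ y == v) ∨ (x == v ∧ y == u)
  a : Fin n → Fin n → Bool
  a x y = adj G x y ∨ (not (x == y) ∧ new x y)
  newSym : ∀ x y → new x y ≡ new y x
  newSym x y rewrite ∧-comm (x == u) (y == v) | ∧-comm (x == v) (y == u)
    = ∨-comm (y == v ∧ x == u) (y == u ∧ x == v)
  s : ∀ x y → a x y ≡ a y x
  s x y rewrite adjSym G x y | ==-sym x y | newSym x y = refl
  i : ∀ x → a x x ≡ false
  i x rewrite adjIrr G x | ==-refl x = refl

edgeCount : ∀ {n} → Graph n → ℕ
edgeCount {n} G =
  length (filterᵇ (λ p → adj G (Data.Product.proj₁ p) (Data.Product.proj₂ p)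
                          ∧ (toℕ (Data.Product.proj₁ p) <ᵇ toℕ (Data.Product.proj₂ p)))
                  (cartesianProduct (allFin n) (allFin n)))

degree : ∀ {n} → Graph n → Fin n → ℕ
degree {n} G v = length (filterᵇ (adj G v) (allFin n))

-- G has a perfect matching: a fixed-point-free involution m pairing every
-- vertex v with a neighbour m v (i.e. the edges {v, m v} form a perfect
-- matching; fixed-point-freeness follows from irreflexivity).
HasPM : ∀ {n} → Graph n → Set
HasPM {n} G = Σ (Fin n → Fin n) λ m → (∀ v → m (m v) ≡ v) × (∀ v → Adj G v (m v))

Legal : ∀ {n} → Graph n → Fin n → Fin n → Set
Legal G u v = (u ≢ v) × (adj G u v ≡ false) × ¬ HasPM (addEdge G u v)

Saturated : ∀ {n} → Graph n → Set
Saturated G = ∀ u v → ¬ Legal G u v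

-- MaxForcesMini k G : it is Mini's turn in position G and Max has a strategy
-- guaranteeing that the final graph has at least k edges, whatever Mini does.
-- MaxForcesMax k G : same, with Max to move.
-- "s(G,PM) ≥ k with Max playing second" is  MaxForcesMini k G.
data MaxForcesMini {n} (k : ℕ) (G : Graph n) : Set
data MaxForcesMax  {n} (k : ℕ) (G : Graph n) : Set

data MaxForcesMini {n} k G where
  miniTurn : (Saturated G → k ≤ edgeCount G)
           → (∀ u v → Legal G u v → MaxForcesMax k (addEdge G u v))
           → MaxForcesMini k G

data MaxForcesMax {n} k G where
  maxEnd  : Saturated G → k ≤ edgeCount G → MaxForcesMax k G
  maxMove : ∀ u v → Legal G u v → MaxForcesMini k (addEdge G u v)
          → MaxForcesMax k G

-- A Hamilton cycle is a cyclic sequence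
-- c 0, c 1, ..., c m (m ≥ 2, so length ≥ 3) of distinct vertices running
-- through exactly the kept vertices, consecutive ones (and c m, c 0) adjacent.
HamiltonCycleOn : ∀ {n} → Graph n → (Fin n → Bool) → Set
HamiltonCycleOn {n} G keep =
  Σ ℕ λ m → Σ (Fin (suc m) → Fin n) λ c →
      (2 ≤ m)
    × (∀ i j → c i ≡ c j → i ≡ j)
    × (∀ v → (keep v ≡ true) ⇔ (∃ λ i → c i ≡ v))
    × (∀ (i : Fin m) → Adj G (c (inject₁ i)) (c (suc i)))
    × Adj G (c (fromℕ m)) (c zero)

HamiltonAfterDeleting4 : ∀ {n} → Graph n → Fin n → Fin n → Fin n → Fin n → Set
HamiltonAfterDeleting4 G w₁ w₂ w₃ w₄ =
  HamiltonCycleOn G (λ x → not (x == w₁ ∨ x == w₂ ∨ x == w₃ ∨ x == w₄))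

-- Max keeps an obstruction to perfect matchings alive for the whole game: either the triangle
-- T = {w₁, w₂, w₃} stays a component of odd order, or w₄ stays isolated. Then every edge between
-- two vertices of the Hamilton cycle C of G₀ ∖ {w₁, w₂, w₃, w₄} stays legal, so the final graph
-- contains a complete graph on the n − 4 vertices of C. Mini's edges inside C are answered inside C.
-- When Mini first joins w₄ (or a triangle vertex) to a cycle vertex z, Max joins w₄ (or another
-- triangle vertex) to a cycle neighbour x of z. From then on every edge between T and the rest (or
-- every edge at w₄) would complete a perfect matching, so it is never legal and the obstruction
-- survives: the four vertices off C together with two suitable cycle vertices c j, c k have a
-- perfect matching, and C − {c j, c k} splits into paths of even order because C has even length.
-- An edge between w₄ and T completes such a matching at once, so Mini cannot play it.

module Submission where

open import Defs
open import Data.Nat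
  using (ℕ; zero; suc; pred; _+_; _*_; _∸_; _≤_; _<_; _<?_; z≤n; s≤s; s≤s⁻¹; _<ᵇ_; >-nonZero)
open import Data.Nat.Properties
open import Data.Nat.Divisibility using (_∣_; divides)
open import Data.Nat.Combinatorics using (_C_; nCk+nC[k+1]≡[n+1]C[k+1]; nC1≡n)
open import Data.Bool using (Bool; true; false; _∧_; _∨_; not; if_then_else_; T?)
open import Data.Bool.Properties using (¬-not; T-≡; ∧-zeroʳ; not-involutive) renaming (_≟_ to _≟ᵇ_)
open import Data.Fin using (Fin; zero; suc; toℕ; fromℕ; fromℕ<; inject₁; splitAt; _↑ˡ_; _↑ʳ_)
  renaming (_≟_ to _≟ᶠ_)
open import Data.Fin.Patterns using (0F; 1F; 2F; 3F; 4F; 5F)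
open import Data.Fin.Properties
  using (any?; all?; ¬∀⟶∃¬; injective⇒≤; toℕ-injective; toℕ<n; toℕ-fromℕ<; toℕ-inject₁; toℕ-fromℕ;
         splitAt-↑ˡ; splitAt-↑ʳ; splitAt⁻¹-↑ˡ; splitAt⁻¹-↑ʳ)
open import Data.List using (List; []; _∷_; _++_; [_]; length; map; upTo; filterᵇ; allFin; cartesianProduct)
open import Data.List.Properties using (length-++; length-map; length-upTo)
open import Data.List.Membership.Propositional using (_∈_)
open import Data.List.Membership.Propositional.Properties
  using (∈-∃++; ∈-filter⁺; ∈-cartesianProduct⁺; ∈-allFin; ∈-map⁻; ∈-upTo⁻; ∈-++⁻)
open import Data.List.Relation.Unary.Any using (here; there)
open import Data.List.Relation.Unary.All using ([]; _∷_)
import Data.List.Relation.Unary.All as All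
open import Data.List.Relation.Unary.AllPairs using ([]; _∷_)
open import Data.List.Relation.Unary.Unique.Propositional using (Unique)
open import Data.List.Relation.Unary.Unique.Propositional.Properties using (++⁺; map⁺; upTo⁺)
open import Data.Vec using (Vec; []; _∷_; lookup)
open import Data.Vec.Functional using () renaming (_∷_ to _∷ᶠ_)
open import Data.Vec.Relation.Unary.All using ([]; _∷_)
open import Data.Vec.Relation.Unary.AllPairs using ([]; _∷_)
open import Data.Vec.Relation.Unary.Unique.Propositional using () renaming (Unique to UniqueVec)
open import Data.Vec.Relation.Unary.Unique.Propositional.Properties using (lookup-injective)
open import Data.Product using (∃; ∃₂; _×_; _,_; proj₁; proj₂; map₂)
open import Data.Sum using (_⊎_; inj₁; inj₂; [_,_]′)
open import Data.Empty using (⊥)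
open import Function using (_∘_; _∘′_; _⇔_; Equivalence; Injective)
open import Relation.Nullary using (¬_; Dec; yes; no; contradiction)
open import Relation.Nullary.Decidable using (⌊_⌋; ¬?; _×-dec_)
open import Relation.Binary.Definitions using (tri<; tri≈; tri>)
open import Relation.Binary.PropositionalEquality
  using (_≡_; _≢_; refl; sym; trans; cong; cong₂; subst; subst₂; module ≡-Reasoning)

private
  variable
    n : ℕ

-- Counting and searching over finite types

injectiveOn⇒length≤ : ∀ {X Y : Set} (xs : List X) (ys : List Y) (f : X → Y) → Unique xs
  → (∀ {a b} → a ∈ xs → b ∈ xs → f a ≡ f b → a ≡ b)
  → (∀ {a} → a ∈ xs → f a ∈ ys) → length xs ≤ length ys
injectiveOn⇒length≤ [] ys f _ _ _ = z≤n
injectiveOn⇒length≤ (x ∷ xs) ys f (x∉xs ∷ u) inj into with ∈-∃++ (into (here refl))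
... | as , bs , refl =
  subst (suc (length xs) ≤_) (sym (length-middle as))
    (s≤s (injectiveOn⇒length≤ xs (as ++ bs) f u (λ a b → inj (there a) (there b))
      (λ a∈ → delete-∈ as (into (there a∈))
                (λ e → All.lookup x∉xs a∈ (inj (here refl) (there a∈) (sym e))))))
  where
  length-middle : ∀ {Y : Set} {y : Y} {bs} (as : List Y) → length (as ++ [ y ] ++ bs) ≡ suc (length (as ++ bs))
  length-middle []       = refl
  length-middle (_ ∷ as) = cong suc (length-middle as)
  delete-∈ : ∀ {Y : Set} {v y : Y} {bs} (as : List Y) → v ∈ as ++ [ y ] ++ bs → v ≢ y → v ∈ as ++ bs
  delete-∈ []       (here v≡y) v≢y = contradiction v≡y v≢y
  delete-∈ []       (there v∈) _   = v∈
  delete-∈ (_ ∷ as) (here v≡a) _   = here v≡a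
  delete-∈ (_ ∷ as) (there v∈) v≢y = there (delete-∈ as v∈ v≢y)

∈-filterᵇ : ∀ {A : Set} (p : A → Bool) {xs : List A} {x : A} → x ∈ xs → p x ≡ true → x ∈ filterᵇ p xs
∈-filterᵇ p x∈ px = ∈-filter⁺ (λ y → T? (p y)) x∈ (Equivalence.from T-≡ px)

surjective⇒≤ : ∀ {m} (f : Fin m → Fin n) → (∀ y → ∃ λ x → f x ≡ y) → n ≤ m
surjective⇒≤ f surj = injective⇒≤ {f = proj₁ ∘ surj}
  λ {y} {y'} e → trans (sym (proj₂ (surj y))) (trans (cong f e) (proj₂ (surj y')))

[,]∘splitAt-injective : ∀ {A : Set} {p q} (f : Fin p → A) (g : Fin q → A)
  → Injective _≡_ _≡_ f → Injective _≡_ _≡_ g → (∀ i j → f i ≢ g j)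
  → Injective _≡_ _≡_ ([ f , g ]′ ∘ splitAt p)
[,]∘splitAt-injective {p = p} f g f-inj g-inj f≢g {i} {i'} e
  with splitAt p i in eqᵢ | splitAt p i' in eqᵢ'
... | inj₁ a | inj₁ b = trans (sym (splitAt⁻¹-↑ˡ eqᵢ)) (trans (cong _ (f-inj e)) (splitAt⁻¹-↑ˡ eqᵢ'))
... | inj₂ a | inj₂ b = trans (sym (splitAt⁻¹-↑ʳ eqᵢ)) (trans (cong _ (g-inj e)) (splitAt⁻¹-↑ʳ eqᵢ'))
... | inj₁ a | inj₂ b = contradiction e (f≢g a b)
... | inj₂ a | inj₁ b = contradiction (sym e) (f≢g b a)

private
  ∷ᶠ-cong : ∀ {A : Set} {m} {a : A} {f g : Fin m → A} → (∀ x → f x ≡ g x) → ∀ x → (a ∷ᶠ f) x ≡ (a ∷ᶠ g) x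
  ∷ᶠ-cong e zero    = refl
  ∷ᶠ-cong e (suc i) = e i

-- P must respect pointwise equality: without function extensionality the search only
-- recovers a witness up to it.
∃-function? : ∀ m k (P : (Fin m → Fin k) → Set) → (∀ f g → (∀ x → f x ≡ g x) → P f → P g)
  → (∀ f → Dec (P f)) → Dec (∃ P)
∃-function? zero k P ext P? with P? (λ ())
... | yes p = yes (_ , p)
... | no ¬p = no λ (f , pf) → ¬p (ext f _ (λ ()) pf)
∃-function? (suc m) k P ext P? with any? (λ a → ∃-function? m k (λ g → P (a ∷ᶠ g))
                                                  (λ f g e → ext _ _ (∷ᶠ-cong e)) (λ g → P? (a ∷ᶠ g)))
... | yes (a , g , p) = yes (_ , p)
... | no ¬p = no λ (f , pf) → ¬p (f zero , f ∘ suc , ext f _ (λ { zero → refl ; (suc i) → refl }) pf)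

-- Graphs and the saturation game

==-false : ∀ {x y : Fin n} → x ≢ y → (x == y) ≡ false
==-false {x = x} {y} x≢y with x ≟ᶠ y
... | yes x≡y = contradiction x≡y x≢y
... | no _    = refl

Adj-sym : ∀ {n} {G : Graph n} {x y} → Adj G x y → Adj G y x
Adj-sym {G = G} {x} {y} = trans (adjSym G y x)

Adj⇒≢ : ∀ {n} {G : Graph n} {x y} → Adj G x y → x ≢ y
Adj⇒≢ {G = G} {x} e refl = contradiction (trans (sym (adjIrr G x)) e) λ ()

¬Adj⇒adj≡false : ∀ {n} (G : Graph n) {x y} → ¬ Adj G x y → adj G x y ≡ false
¬Adj⇒adj≡false G = ¬-not

Adj? : (G : Graph n) → ∀ x y → Dec (Adj G x y)
Adj? G x y = adj G x y ≟ᵇ true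

addEdge-⊇ : ∀ {n} {G : Graph n} {u v x y} → Adj G x y → Adj (addEdge G u v) x y
addEdge-⊇ e rewrite e = refl

addEdge-new : ∀ {n} {G : Graph n} {u v} → u ≢ v → Adj (addEdge G u v) u v
addEdge-new {G = G} {u} {v} u≢v rewrite ==-false u≢v | ==-refl u | ==-refl v with adj G u v
... | true  = refl
... | false = refl

private
  ∧false≢true : ∀ {b} → b ∧ false ≢ true
  ∧false≢true {b} rewrite ∧-zeroʳ b = λ ()

addEdge-⊆ : ∀ {n} {G : Graph n} {u v x y} → Adj (addEdge G u v) x y → Adj G x y ⊎ (x ≡ u × y ≡ v) ⊎ (x ≡ v × y ≡ u)
addEdge-⊆ {G = G} {u} {v} {x} {y} e with adj G x y | x ≟ᶠ u | y ≟ᶠ v | x ≟ᶠ v | y ≟ᶠ u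
... | true  | _     | _     | _     | _     = inj₁ refl
... | false | yes p | yes q | _     | _     = inj₂ (inj₁ (p , q))
... | false | _     | _     | yes p | yes q = inj₂ (inj₂ (p , q))
... | false | no _  | _     | no _  | _     = contradiction e ∧false≢true
... | false | no _  | _     | yes _ | no _  = contradiction e ∧false≢true
... | false | yes _ | no _  | no _  | _     = contradiction e ∧false≢true
... | false | yes _ | no _  | yes _ | no _  = contradiction e ∧false≢true

addEdge-elsewhere : ∀ {n} {G : Graph n} {u v s x} → adj G s x ≡ false → s ≢ u → s ≢ v → adj (addEdge G u v) s x ≡ false
addEdge-elsewhere {G = G} {u} {v} {s} {x} ¬sx s≢u s≢v with adj (addEdge G u v) s x in sx
... | false = refl
... | true with addEdge-⊆ {G = G} sx
...   | inj₁ old             = contradiction (trans (sym ¬sx) old) λ ()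
...   | inj₂ (inj₁ (e , _)) = contradiction e s≢u
...   | inj₂ (inj₂ (e , _)) = contradiction e s≢v

HasPM? : (G : Graph n) → Dec (HasPM G)
HasPM? {n} G = ∃-function? n n _ respects
  (λ m → all? (λ v → m (m v) ≟ᶠ v) ×-dec all? (λ v → Adj? G v (m v)))
  where
  respects : ∀ f g → (∀ x → f x ≡ g x) → ((∀ v → f (f v) ≡ v) × (∀ v → Adj G v (f v)))
                                       → ((∀ v → g (g v) ≡ v) × (∀ v → Adj G v (g v)))
  respects f g f≗g (invol , adjacent) =
      (λ v → trans (sym (trans (cong f (f≗g v)) (f≗g (g v)))) (invol v))
    , (λ v → subst (Adj G v) (f≗g v) (adjacent v))

Legal? : (G : Graph n) → ∀ u v → Dec (Legal G u v)
Legal? G u v = ¬? (u ≟ᶠ v) ×-dec ((adj G u v ≟ᵇ false) ×-dec ¬? (HasPM? (addEdge G u v)))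

Saturated? : (G : Graph n) → Dec (Saturated G)
Saturated? G = all? λ u → all? λ v → ¬? (Legal? G u v)

¬Saturated⇒legal : ∀ {n} {G : Graph n} → ¬ Saturated G → ∃₂ (Legal G)
¬Saturated⇒legal {n} {G} ¬sat
  with u , ¬∀v ← ¬∀⟶∃¬ n _ (λ u → all? λ v → ¬? (Legal? G u v)) ¬sat
  with v , ¬¬legal ← ¬∀⟶∃¬ n _ (λ v → ¬? (Legal? G u v)) ¬∀v
  with Legal? G u v
... | yes legal = u , v , legal
... | no ¬legal = contradiction ¬legal ¬¬legal

filterᵇ-length-≤ : ∀ {A : Set} (p q : A → Bool) (xs : List A) → (∀ x → q x ≡ true → p x ≡ true)
  → length (filterᵇ q xs) ≤ length (filterᵇ p xs)
filterᵇ-length-≤ p q [] q⊆p = z≤n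
filterᵇ-length-≤ p q (x ∷ xs) q⊆p with q x in qx | p x in px
... | true  | true  = s≤s (filterᵇ-length-≤ p q xs q⊆p)
... | true  | false = contradiction (trans (sym px) (q⊆p x qx)) λ ()
... | false | true  = m≤n⇒m≤1+n (filterᵇ-length-≤ p q xs q⊆p)
... | false | false = filterᵇ-length-≤ p q xs q⊆p

filterᵇ-length-< : ∀ {A : Set} (p q : A → Bool) (xs : List A) → (∀ x → q x ≡ true → p x ≡ true)
  → ∀ {z} → z ∈ xs → p z ≡ true → q z ≡ false
  → length (filterᵇ q xs) < length (filterᵇ p xs)
filterᵇ-length-< p q (x ∷ xs) q⊆p (here refl) pz qz rewrite pz | qz = s≤s (filterᵇ-length-≤ p q xs q⊆p)
filterᵇ-length-< p q (x ∷ xs) q⊆p (there z∈) pz qz with q x in qx | p x in px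
... | true  | true  = s≤s (filterᵇ-length-< p q xs q⊆p z∈ pz qz)
... | true  | false = contradiction (trans (sym px) (q⊆p x qx)) λ ()
... | false | true  = m≤n⇒m≤1+n (filterᵇ-length-< p q xs q⊆p z∈ pz qz)
... | false | false = filterᵇ-length-< p q xs q⊆p z∈ pz qz

allPairs : ∀ n → List (Fin n × Fin n)
allPairs n = cartesianProduct (allFin n) (allFin n)

∈-allPairs : ∀ (x y : Fin n) → (x , y) ∈ allPairs n
∈-allPairs x y = ∈-cartesianProduct⁺ (∈-allFin x) (∈-allFin y)

nonEdgeCount : Graph n → ℕ
nonEdgeCount {n} G = length (filterᵇ (λ p → not (adj G (proj₁ p) (proj₂ p))) (allPairs n))

nonEdgeCount-< : ∀ (G : Graph n) u v → Legal G u v → nonEdgeCount (addEdge G u v) < nonEdgeCount G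
nonEdgeCount-< {n} G u v (u≢v , ¬uv , _) =
  filterᵇ-length-< _ _ (allPairs n) still-missing (∈-allPairs u v) (cong not ¬uv) (cong not (addEdge-new {G = G} u≢v))
  where
  still-missing : ∀ p → not (adj (addEdge G u v) (proj₁ p) (proj₂ p)) ≡ true → not (adj G (proj₁ p) (proj₂ p)) ≡ true
  still-missing (a , b) e with adj G a b in ab
  ... | false = refl
  ... | true  = contradiction e λ ()

module InvariantStrategy {n} (k : ℕ) (P : Graph n → Set)
  (preserved : ∀ G u v → P G → Legal G u v → P (addEdge G u v))
  (final : ∀ G → P G → Saturated G → k ≤ edgeCount G) where

  private
    fromMini : ∀ fuel G → nonEdgeCount G < fuel → P G → MaxForcesMini k G
    fromMax  : ∀ fuel G → nonEdgeCount G < fuel → P G → MaxForcesMax k G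
    fromMini (suc fuel) G bound p =
      miniTurn (final G p) λ u v legal →
        fromMax fuel (addEdge G u v) (<-≤-trans (nonEdgeCount-< G u v legal) (s≤s⁻¹ bound)) (preserved G u v p legal)
    fromMax (suc fuel) G bound p with Saturated? G
    ... | yes sat = maxEnd sat (final G p sat)
    ... | no ¬sat with u , v , legal ← ¬Saturated⇒legal {G = G} ¬sat =
      maxMove u v legal
        (fromMini fuel (addEdge G u v) (<-≤-trans (nonEdgeCount-< G u v legal) (s≤s⁻¹ bound)) (preserved G u v p legal))

  maxForcesMini : ∀ G → P G → MaxForcesMini k G
  maxForcesMini G = fromMini (suc (nonEdgeCount G)) G ≤-refl

  maxForcesMax : ∀ G → P G → MaxForcesMax k G
  maxForcesMax G = fromMax (suc (nonEdgeCount G)) G ≤-refl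

degree-≥ : ∀ (G : Graph n) v xs → Unique xs → (∀ {x} → x ∈ xs → Adj G v x) → length xs ≤ degree G v
degree-≥ {n} G v xs unique adjacent =
  injectiveOn⇒length≤ xs (filterᵇ (adj G v) (allFin n)) (λ x → x) unique (λ _ _ e → e)
    (λ x∈ → ∈-filterᵇ (adj G v) (∈-allFin _) (adjacent x∈))

degree-0⇒¬Adj : ∀ (G : Graph n) {v} → degree G v ≡ 0 → ∀ x → adj G v x ≡ false
degree-0⇒¬Adj G {v} deg x = ¬Adj⇒adj≡false G λ vx →
  contradiction (subst (1 ≤_) deg (degree-≥ G v (x ∷ []) ([] ∷ []) λ { (here refl) → vx })) λ ()

degree-2⇒¬Adj : ∀ (G : Graph n) {v a b} → degree G v ≡ 2 → Adj G v a → Adj G v b → a ≢ b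
  → ∀ x → x ≢ a → x ≢ b → adj G v x ≡ false
degree-2⇒¬Adj G {v} {a} {b} deg va vb a≢b x x≢a x≢b = ¬Adj⇒adj≡false G λ vx →
  contradiction (subst (3 ≤_) deg (degree-≥ G v (a ∷ b ∷ x ∷ [])
    ((a≢b ∷ (x≢a ∘ sym) ∷ []) ∷ ((x≢b ∘ sym) ∷ []) ∷ [] ∷ [])
    λ { (here refl) → va ; (there (here refl)) → vb ; (there (there (here refl))) → vx })) (<-irrefl refl)

pairsBelow : ℕ → List (ℕ × ℕ)
pairsBelow zero    = []
pairsBelow (suc l) = pairsBelow l ++ map (_, l) (upTo l)

length-pairsBelow : ∀ l → length (pairsBelow l) ≡ l C 2
length-pairsBelow zero    = refl
length-pairsBelow (suc l) = begin
  length (pairsBelow l ++ map (_, l) (upTo l))   ≡⟨ length-++ (pairsBelow l) ⟩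
  length (pairsBelow l) + length (map (_, l) (upTo l))
    ≡⟨ cong₂ _+_ (length-pairsBelow l) (trans (length-map (_, l) (upTo l)) (length-upTo l)) ⟩
  l C 2 + l                                      ≡⟨ +-comm (l C 2) l ⟩
  l + l C 2                                      ≡⟨ cong (_+ l C 2) (sym (nC1≡n l)) ⟩
  l C 1 + l C 2                                  ≡⟨ nCk+nC[k+1]≡[n+1]C[k+1] l 1 ⟩
  suc l C 2                                      ∎
  where open ≡-Reasoning

∈-pairsBelow⁻ : ∀ l {p q} → (p , q) ∈ pairsBelow l → p < q × q < l
∈-pairsBelow⁻ (suc l) pq∈ with ∈-++⁻ (pairsBelow l) pq∈
... | inj₁ pq∈′ = map₂ m<n⇒m<1+n (∈-pairsBelow⁻ l pq∈′)
... | inj₂ pq∈′ with p , p∈ , refl ← ∈-map⁻ (_, l) pq∈′ = ∈-upTo⁻ p∈ , n<1+n l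

pairsBelow-unique : ∀ l → Unique (pairsBelow l)
pairsBelow-unique zero    = []
pairsBelow-unique (suc l) = ++⁺ (pairsBelow-unique l) (map⁺ (cong proj₁) (upTo⁺ l)) disjoint
  where
  disjoint : ∀ {pq} → ¬ (pq ∈ pairsBelow l × pq ∈ map (_, l) (upTo l))
  disjoint (pq∈ , pq∈′) with p , _ , refl ← ∈-map⁻ (_, l) pq∈′ = <-irrefl refl (proj₂ (∈-pairsBelow⁻ l pq∈))

-- edgeCount counts the pair (a , b) of an edge only when toℕ a < toℕ b.
ordered : Fin n → Fin n → Fin n × Fin n
ordered a b = if toℕ a <ᵇ toℕ b then (a , b) else (b , a)

ordered-injective : ∀ (a b a′ b′ : Fin n) → ordered a b ≡ ordered a′ b′
  → (a ≡ a′ × b ≡ b′) ⊎ (a ≡ b′ × b ≡ a′)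
ordered-injective a b a′ b′ e with toℕ a <ᵇ toℕ b | toℕ a′ <ᵇ toℕ b′
... | true  | true  = inj₁ (cong proj₁ e , cong proj₂ e)
... | true  | false = inj₂ (cong proj₁ e , cong proj₂ e)
... | false | true  = inj₂ (cong proj₂ e , cong proj₁ e)
... | false | false = inj₁ (cong proj₂ e , cong proj₁ e)

isOrderedEdge : Graph n → Fin n × Fin n → Bool
isOrderedEdge G p = adj G (proj₁ p) (proj₂ p) ∧ (toℕ (proj₁ p) <ᵇ toℕ (proj₂ p))

ordered-edge : ∀ (G : Graph n) {a b} → Adj G a b → isOrderedEdge G (ordered a b) ≡ true
ordered-edge G {a} {b} ab with toℕ a <ᵇ toℕ b in a<b
... | true  rewrite ab | a<b = refl
... | false rewrite Adj-sym {G = G} ab = Equivalence.to T-≡ (<⇒<ᵇ b<a)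
  where
  b<a : toℕ b < toℕ a
  b<a = ≤∧≢⇒< (≮⇒≥ λ a<b′ → contradiction (trans (sym a<b) (Equivalence.to T-≡ (<⇒<ᵇ a<b′))) λ ())
              (λ e → Adj⇒≢ {G = G} ab (toℕ-injective (sym e)))

clique⇒C2≤edgeCount : ∀ (G : Graph n) L (c : ℕ → Fin n)
  → (∀ {p q} → p < L → q < L → c p ≡ c q → p ≡ q)
  → (∀ {p q} → p < q → q < L → Adj G (c p) (c q))
  → L C 2 ≤ edgeCount G
clique⇒C2≤edgeCount {n} G L c c-inj clique =
  subst (_≤ edgeCount G) (length-pairsBelow L)
    (injectiveOn⇒length≤ (pairsBelow L) (filterᵇ (isOrderedEdge G) (allPairs n)) (λ (p , q) → ordered (c p) (c q))
      (pairsBelow-unique L) injective into)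
  where
  into : ∀ {pq} → pq ∈ pairsBelow L → ordered (c (proj₁ pq)) (c (proj₂ pq)) ∈ filterᵇ (isOrderedEdge G) (allPairs n)
  into {p , q} pq∈ with p<q , q<L ← ∈-pairsBelow⁻ L pq∈ =
    ∈-filterᵇ (isOrderedEdge G) (∈-allPairs _ _) (ordered-edge G (clique p<q q<L))
  injective : ∀ {pq pq′} → pq ∈ pairsBelow L → pq′ ∈ pairsBelow L
    → ordered (c (proj₁ pq)) (c (proj₂ pq)) ≡ ordered (c (proj₁ pq′)) (c (proj₂ pq′)) → pq ≡ pq′
  injective {p , q} {p′ , q′} pq∈ pq′∈ e
    with p<q , q<L ← ∈-pairsBelow⁻ L pq∈ | p′<q′ , q′<L ← ∈-pairsBelow⁻ L pq′∈
    with ordered-injective (c p) (c q) (c p′) (c q′) e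
  ... | inj₁ (p≡ , q≡) = cong₂ _,_ (c-inj (<-trans p<q q<L) (<-trans p′<q′ q′<L) p≡) (c-inj q<L q′<L q≡)
  ... | inj₂ (p≡ , q≡) = contradiction
          (subst₂ _<_ (sym (c-inj q<L (<-trans p′<q′ q′<L) q≡)) (sym (c-inj (<-trans p<q q<L) q′<L p≡)) p′<q′)
          (<-asym p<q)

-- Pairing up the positions of a path

even : ℕ → Bool
even zero    = true
even (suc p) = not (even p)

parity-gap : ∀ {p x} → p < x → even (suc p) ≢ even x → suc p < x
parity-gap p<x parity = ≤∧≢⇒< p<x (parity ∘′ cong even)

even-or-odd : ∀ q → even q ≡ true ⊎ even q ≡ false
even-or-odd q with even q
... | true  = inj₁ refl
... | false = inj₂ refl

record EvenOddPair (L : ℕ) : Set where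
  constructor evenOdd
  field
    j k    : ℕ
    even-j : even j ≡ true
    odd-k  : even k ≡ false
    j<k    : j < k
    k<L    : k < L

-- For even L, the positions 0 … L − 1 other than j and k form the segments [0 , j), (j , k)
-- and (k , L), each of even length; pair every position with its neighbour inside its segment.
module SegmentPairing {L : ℕ} (even-L : even L ≡ true) (jk : EvenOddPair L) where

  open EvenOddPair jk

  between : ℕ → Bool
  between p = ⌊ j <? p ⌋ ∧ ⌊ p <? k ⌋

  pairsUp : ℕ → Bool
  pairsUp p = if between p then not (even p) else even p

  partner : ℕ → ℕ
  partner p = if pairsUp p then suc p else pred p

  partner-up : ∀ {p} → pairsUp p ≡ true → partner p ≡ suc p
  partner-up e rewrite e = refl

  partner-down : ∀ {p} → pairsUp p ≡ false → partner p ≡ pred p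
  partner-down e rewrite e = refl

  data Paired : ℕ → Set where
    up   : ∀ {p} → pairsUp p ≡ true → suc p < L → suc p ≢ j → suc p ≢ k → pairsUp (suc p) ≡ false → Paired p
    down : ∀ {q} → pairsUp (suc q) ≡ false → q ≢ j → q ≢ k → pairsUp q ≡ true → Paired (suc q)

  private
    before : ∀ {p} → p < j → between p ≡ false
    before {p} p<j with j <? p
    ... | yes j<p = contradiction p<j (<-asym j<p)
    ... | no _    = refl

    inside : ∀ {p} → j < p → p < k → between p ≡ true
    inside {p} j<p p<k with j <? p | p <? k
    ... | yes _ | yes _  = refl
    ... | no ¬j<p | _    = contradiction j<p ¬j<p
    ... | yes _ | no ¬p<k = contradiction p<k ¬p<k

    after : ∀ {p} → k ≤ p → between p ≡ false
    after {p} k≤p with j <? p | p <? k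
    ... | yes _ | yes p<k = contradiction k≤p (<⇒≱ p<k)
    ... | yes _ | no _    = refl
    ... | no _  | _       = refl

    outer : ∀ {p} → between p ≡ false → pairsUp p ≡ even p
    outer e rewrite e = refl

    inner : ∀ {p} → between p ≡ true → pairsUp p ≡ not (even p)
    inner e rewrite e = refl

    true≢false : true ≢ false
    true≢false ()

    paired-before : ∀ p → p < j → Paired p
    paired-before p p<j with even p in ep
    ... | true = up (trans (outer (before p<j)) ep) (<-trans sp<j (<-trans j<k k<L)) (<⇒≢ sp<j)
                    (<⇒≢ (<-trans sp<j j<k)) (trans (outer (before sp<j)) (cong not ep))
      where
      sp<j : suc p < j
      sp<j = parity-gap p<j (λ e → true≢false (trans (sym even-j) (trans (sym e) (cong not ep))))
    paired-before (suc q) q<j | false =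
      down (trans (outer (before q<j)) ep) (<⇒≢ (<-trans (n<1+n q) q<j))
           (<⇒≢ (<-trans (<-trans (n<1+n q) q<j) j<k))
           (trans (outer (before (<-trans (n<1+n q) q<j))) (trans (sym (not-involutive (even q))) (cong not ep)))

    parity-gap-below : ∀ {x q} → x < suc q → even (suc q) ≢ even (suc x) → x < q
    parity-gap-below x<sq parity = ≤∧≢⇒< (s≤s⁻¹ x<sq) (λ e → parity (cong (even ∘′ suc) (sym e)))

    paired-between : ∀ p → j < p → p < k → Paired p
    paired-between p j<p p<k with even p in ep
    ... | false = up (trans (inner (inside j<p p<k)) (cong not ep)) (<-trans sp<k k<L)
                     (λ e → <-irrefl (sym e) (<-trans j<p (n<1+n p))) (<⇒≢ sp<k)
                     (trans (inner (inside (<-trans j<p (n<1+n p)) sp<k)) (cong not (cong not ep)))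
      where
      sp<k : suc p < k
      sp<k = parity-gap p<k (λ e → true≢false (trans (sym (cong not ep)) (trans e odd-k)))
    paired-between (suc q) j<p p<k | true =
      down (trans (inner (inside j<p p<k)) (cong not ep)) (λ e → <-irrefl (sym e) j<q)
           (<⇒≢ (<-trans (n<1+n q) p<k)) (trans (inner (inside j<q (<-trans (n<1+n q) p<k))) ep)
      where
      j<q : j < q
      j<q = parity-gap-below j<p (λ e → true≢false (trans (sym ep) (trans e (cong not even-j))))

    paired-after : ∀ p → k < p → p < L → Paired p
    paired-after p k<p p<L with even p in ep
    ... | true = up (trans (outer (after (<⇒≤ k<p))) ep) sp<L
                    (λ e → <-irrefl (sym e) (<-trans (<-trans j<k k<p) (n<1+n p)))
                    (λ e → <-irrefl (sym e) (<-trans k<p (n<1+n p)))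
                    (trans (outer (after (<⇒≤ (<-trans k<p (n<1+n p))))) (cong not ep))
      where
      sp<L : suc p < L
      sp<L = parity-gap p<L (λ e → true≢false (trans (sym even-L) (trans (sym e) (cong not ep))))
    paired-after (suc q) k<p p<L | false =
      down (trans (outer (after (<⇒≤ k<p))) ep) (λ e → <-irrefl (sym e) (<-trans j<k k<q))
           (λ e → <-irrefl (sym e) k<q)
           (trans (outer (after (<⇒≤ k<q))) (trans (sym (not-involutive (even q))) (cong not ep)))
      where
      k<q : k < q
      k<q = parity-gap-below k<p (λ e → true≢false (trans (sym (trans e (cong not odd-k))) ep))

  paired : ∀ p → p < L → p ≢ j → p ≢ k → Paired p
  paired p p<L p≢j p≢k with <-cmp p j
  ... | tri< p<j _ _   = paired-before p p<j
  ... | tri≈ _ p≡j _   = contradiction p≡j p≢j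
  ... | tri> _ _ j<p with <-cmp p k
  ...   | tri< p<k _ _ = paired-between p j<p p<k
  ...   | tri≈ _ p≡k _ = contradiction p≡k p≢k
  ...   | tri> _ _ k<p = paired-after p k<p p<L


-- Cyclic orders, and extending matchings along them

-- Positions are natural numbers rather than elements of Fin L, to allow arithmetic on them.
record CyclicOrder {n} (onCycle : Fin n → Bool) (L : ℕ) : Set where
  field
    at     : ℕ → Fin n
    pos    : Fin n → ℕ
    at-on  : ∀ p → p < L → onCycle (at p) ≡ true
    pos-at : ∀ p → p < L → pos (at p) ≡ p
    pos<   : ∀ v → onCycle v ≡ true → pos v < L
    at-pos : ∀ v → onCycle v ≡ true → at (pos v) ≡ v

  at-injective : ∀ {p q} → p < L → q < L → at p ≡ at q → p ≡ q
  at-injective {p} {q} p<L q<L e = trans (sym (pos-at p p<L)) (trans (cong pos e) (pos-at q q<L))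

open CyclicOrder public

module _ {n} {onCycle : Fin n → Bool} {L : ℕ} where

  PathIn : Graph n → CyclicOrder onCycle L → Set
  PathIn G cy = ∀ p → suc p < L → Adj G (at cy p) (at cy (suc p))

  CycleIn : Graph n → CyclicOrder onCycle L → Set
  CycleIn G cy = PathIn G cy × Adj G (at cy (pred L)) (at cy 0)

  CycleIn-addEdge : ∀ {G} (cy : CyclicOrder onCycle L) {u v} → CycleIn G cy → CycleIn (addEdge G u v) cy
  CycleIn-addEdge {G} cy (path , closing) = (λ p sp<L → addEdge-⊇ {G = G} (path p sp<L)) , addEdge-⊇ {G = G} closing

  -- rotate lists the cycle from position i on: c i , … , c (L − 1) , c 0 , … , c (i − 1).
  module Rotation (cy : CyclicOrder onCycle L) (i : ℕ) (i<L : i < L) where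

    private
      r : ℕ
      r = L ∸ i

      i+r≡L : i + r ≡ L
      i+r≡L = m+[n∸m]≡n (<⇒≤ i<L)

      0<r : 0 < r
      0<r = m<n⇒0<n∸m i<L

      at′ : ℕ → Fin n
      at′ p with p <? r
      ... | yes _ = at cy (i + p)
      ... | no _  = at cy (p ∸ r)

      pos′ : Fin n → ℕ
      pos′ v with pos cy v <? i
      ... | yes _ = pos cy v + r
      ... | no _  = pos cy v ∸ i

      at′-front : ∀ {p} → p < r → at′ p ≡ at cy (i + p)
      at′-front {p} p<r with p <? r
      ... | yes _   = refl
      ... | no ¬p<r = contradiction p<r ¬p<r

      at′-back : ∀ {p} → r ≤ p → at′ p ≡ at cy (p ∸ r)
      at′-back {p} r≤p with p <? r
      ... | yes p<r = contradiction r≤p (<⇒≱ p<r)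
      ... | no _    = refl

      pos′-front : ∀ {v} → pos cy v < i → pos′ v ≡ pos cy v + r
      pos′-front {v} p<i with pos cy v <? i
      ... | yes _   = refl
      ... | no ¬p<i = contradiction p<i ¬p<i

      pos′-back : ∀ {v} → i ≤ pos cy v → pos′ v ≡ pos cy v ∸ i
      pos′-back {v} i≤p with pos cy v <? i
      ... | yes p<i = contradiction i≤p (<⇒≱ p<i)
      ... | no _    = refl

      i+p<L : ∀ {p} → p < r → i + p < L
      i+p<L {p} p<r = subst (i + p <_) i+r≡L (+-monoʳ-< i p<r)

      p∸r<i : ∀ {p} → p < L → r ≤ p → p ∸ r < i
      p∸r<i {p} p<L r≤p = +-cancelʳ-< r (p ∸ r) i
        (subst₂ _<_ (sym (m∸n+n≡m r≤p)) (sym i+r≡L) p<L)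

      p∸r<L : ∀ {p} → p < L → p ∸ r < L
      p∸r<L p<L = ≤-<-trans (m∸n≤m _ r) p<L

      at′-on : ∀ p → p < L → onCycle (at′ p) ≡ true
      at′-on p p<L with p <? r
      ... | yes p<r = at-on cy (i + p) (i+p<L p<r)
      ... | no _    = at-on cy (p ∸ r) (p∸r<L p<L)

      pos′-at′ : ∀ p → p < L → pos′ (at′ p) ≡ p
      pos′-at′ p p<L with p <? r
      ... | yes p<r =
        let e = pos-at cy (i + p) (i+p<L p<r) in
        trans (pos′-back (subst (i ≤_) (sym e) (m≤m+n i p))) (trans (cong (_∸ i) e) (m+n∸m≡n i p))
      ... | no ¬p<r =
        let r≤p = ≮⇒≥ ¬p<r ; e = pos-at cy (p ∸ r) (p∸r<L p<L) in
        trans (pos′-front (subst (_< i) (sym e) (p∸r<i p<L r≤p))) (trans (cong (_+ r) e) (m∸n+n≡m r≤p))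

      pos′< : ∀ v → onCycle v ≡ true → pos′ v < L
      pos′< v on with pos cy v <? i
      ... | yes p<i = subst (pos cy v + r <_) i+r≡L (+-monoˡ-< r p<i)
      ... | no _    = ≤-<-trans (m∸n≤m (pos cy v) i) (pos< cy v on)

      at′-pos′ : ∀ v → onCycle v ≡ true → at′ (pos′ v) ≡ v
      at′-pos′ v on with pos cy v <? i
      ... | yes _ = trans (at′-back (m≤n+m r (pos cy v))) (trans (cong (at cy) (m+n∸n≡m (pos cy v) r)) (at-pos cy v on))
      ... | no ¬p<i =
        let i≤p = ≮⇒≥ ¬p<i in
        trans (at′-front (+-cancelˡ-< i (pos cy v ∸ i) r
                 (subst₂ _<_ (sym (m+[n∸m]≡n i≤p)) (sym i+r≡L) (pos< cy v on))))
              (trans (cong (at cy) (m+[n∸m]≡n i≤p)) (at-pos cy v on))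

    rotate : CyclicOrder onCycle L
    rotate = record { at = at′ ; pos = pos′ ; at-on = at′-on ; pos-at = pos′-at′ ; pos< = pos′< ; at-pos = at′-pos′ }

    rotate-at-0 : at rotate 0 ≡ at cy i
    rotate-at-0 = trans (at′-front 0<r) (cong (at cy) (+-identityʳ i))

    rotate-CycleIn : ∀ {G} → CycleIn G cy → CycleIn G rotate
    rotate-CycleIn {G} (path , closing) = path′ , closing′
      where
      path′ : PathIn G rotate
      path′ p sp<L with <-≤-connex (suc p) r | <-≤-connex p r
      ... | inj₁ sp<r | _ =
        subst₂ (Adj G) (sym (at′-front (<-trans (n<1+n p) sp<r)))
          (sym (trans (at′-front sp<r) (cong (at cy) (+-suc i p))))
          (path (i + p) (subst (_< L) (+-suc i p) (i+p<L sp<r)))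
      ... | inj₂ r≤sp | inj₁ p<r =
        let sp≡r = ≤-antisym p<r r≤sp in
        subst₂ (Adj G)
          (sym (trans (at′-front p<r)
                 (cong (at cy) (cong pred (trans (sym (+-suc i p)) (trans (cong (i +_) sp≡r) i+r≡L))))))
          (sym (trans (at′-back r≤sp) (cong (at cy) (trans (cong (_∸ r) sp≡r) (n∸n≡0 r)))))
          closing
      ... | inj₂ r≤sp | inj₂ r≤p =
        subst₂ (Adj G) (sym (at′-back r≤p)) (sym (trans (at′-back r≤sp) (cong (at cy) (+-∸-assoc 1 r≤p))))
          (path (p ∸ r) (subst (_< L) (+-∸-assoc 1 r≤p) (≤-<-trans (m∸n≤m (suc p) r) sp<L)))
      sL : suc (pred L) ≡ L
      sL = suc-pred L {{>-nonZero (≤-<-trans z≤n i<L)}}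
      closing′ : Adj G (at′ (pred L)) (at′ 0)
      closing′ with <-≤-connex (pred L) r
      ... | inj₁ pL<r =
        subst₂ (Adj G) (sym (trans (at′-front pL<r) (cong (λ m → at cy (m + pred L)) i≡0)))
          (sym (trans rotate-at-0 (cong (at cy) i≡0))) closing
        where
        i≡0 : i ≡ 0
        i≡0 = n≤0⇒n≡0 (+-cancelʳ-≤ r i 0 (subst (_≤ r) (sym i+r≡L) (subst (_≤ r) sL pL<r)))
      ... | inj₂ r≤pL =
        subst₂ (Adj G) (sym (at′-back r≤pL)) (sym (trans rotate-at-0 (cong (at cy) (sym s≡i))))
          (path (pred L ∸ r) (subst (_< L) (sym s≡i) i<L))
        where
        s≡i : suc (pred L ∸ r) ≡ i
        s≡i = trans (sym (+-∸-assoc 1 r≤pL))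
                (trans (cong (_∸ r) sL) (trans (cong (_∸ r) (sym i+r≡L)) (m+n∸n≡m i r)))

module _ {n} {onCycle : Fin n → Bool} where

  Complete : Graph n → Set
  Complete G = ∀ x y → onCycle x ≡ true → onCycle y ≡ true → x ≢ y → Adj G x y

  Complete-addEdge : ∀ {G u v} → Complete G → Complete (addEdge G u v)
  Complete-addEdge {G} complete x y x-on y-on x≢y = addEdge-⊇ {G = G} (complete x y x-on y-on x≢y)

  MissingEdge : Graph n → Fin n → Fin n → Set
  MissingEdge G x y = onCycle x ≡ true × onCycle y ≡ true × x ≢ y × adj G x y ≡ false

  complete-or-missing : ∀ G → Complete G ⊎ ∃₂ (MissingEdge G)
  complete-or-missing G with any? (λ x → any? λ y →
    (onCycle x ≟ᵇ true) ×-dec (onCycle y ≟ᵇ true) ×-dec ¬? (x ≟ᶠ y) ×-dec (adj G x y ≟ᵇ false))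
  ... | yes (x , y , missing) = inj₂ (x , y , missing)
  ... | no ¬missing = inj₁ λ x y x-on y-on x≢y →
    ¬-not λ xy≡false → ¬missing (x , y , x-on , y-on , x≢y , xy≡false)

  saturated⇒complete : ∀ G → Saturated G
    → (∀ x y → onCycle x ≡ true → onCycle y ≡ true → ¬ HasPM (addEdge G x y)) → Complete G
  saturated⇒complete G saturated stays-unmatched x y x-on y-on x≢y with Adj? G x y
  ... | yes xy = xy
  ... | no ¬xy = contradiction (x≢y , ¬Adj⇒adj≡false G ¬xy , stays-unmatched x y x-on y-on) (saturated x y)

record OffCycleListing {n} (onCycle : Fin n → Bool) (q : ℕ) : Set where
  field
    vertex      : Fin q → Fin n
    injective   : ∀ {a b} → vertex a ≡ vertex b → a ≡ b
    off         : ∀ i → onCycle (vertex i) ≡ false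
    exhaustive  : ∀ v → onCycle v ≡ false → ∃ λ i → vertex i ≡ v

-- A perfect matching of the off-cycle vertices together with c j and c k extends along the
-- cycle, because removing c j and c k leaves three paths with an even number of vertices.
module ExtendAlongCycle {n} {onCycle : Fin n → Bool} {L q}
  (cy : CyclicOrder onCycle L) (G : Graph n) (path : PathIn G cy) (out : OffCycleListing onCycle q)
  (even-L : even L ≡ true) (jk : EvenOddPair L) where

  open EvenOddPair jk
  open SegmentPairing even-L jk
  open OffCycleListing out

  private
    j<L : j < L
    j<L = <-trans j<k k<L

    chordEnd : Fin 2 → Fin n
    chordEnd 0F = at cy j
    chordEnd 1F = at cy k

  special : Fin (q + 2) → Fin n
  special = [ vertex , chordEnd ]′ ∘ splitAt q

  private
    on≢off : ∀ {v w} → onCycle v ≡ true → onCycle w ≡ false → v ≢ w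
    on≢off on off refl = contradiction (trans (sym on) off) λ ()

    special-injective : ∀ {a b} → special a ≡ special b → a ≡ b
    special-injective = [,]∘splitAt-injective vertex chordEnd injective chordEnd-injective
      λ i e eq → on≢off (chordEnd-on e) (off i) (sym eq)
      where
      chordEnd-on : ∀ e → onCycle (chordEnd e) ≡ true
      chordEnd-on 0F = at-on cy j j<L
      chordEnd-on 1F = at-on cy k k<L
      chordEnd-injective : ∀ {a b} → chordEnd a ≡ chordEnd b → a ≡ b
      chordEnd-injective {0F} {0F} _ = refl
      chordEnd-injective {0F} {1F} e = contradiction (at-injective cy j<L k<L e) (<⇒≢ j<k)
      chordEnd-injective {1F} {0F} e = contradiction (at-injective cy k<L j<L e) (<⇒≢ j<k ∘ sym)
      chordEnd-injective {1F} {1F} _ = refl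

    special-cases : ∀ a → (∃ λ i → special a ≡ vertex i) ⊎ special a ≡ at cy j ⊎ special a ≡ at cy k
    special-cases a with splitAt q a
    ... | inj₁ i  = inj₁ (i , refl)
    ... | inj₂ 0F = inj₂ (inj₁ refl)
    ... | inj₂ 1F = inj₂ (inj₂ refl)

    at-not-special : ∀ p → p < L → p ≢ j → p ≢ k → ∀ a → at cy p ≢ special a
    at-not-special p p<L p≢j p≢k a e with special-cases a
    ... | inj₁ (i , eq)  = on≢off (at-on cy p p<L) (off i) (trans e eq)
    ... | inj₂ (inj₁ eq) = p≢j (at-injective cy p<L j<L (trans e eq))
    ... | inj₂ (inj₂ eq) = p≢k (at-injective cy p<L k<L (trans e eq))

    SpecialVertex : Fin n → Set
    SpecialVertex v = ∃ λ a → v ≡ special a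

    ordinary-position : ∀ v → ¬ SpecialVertex v → ∃ λ p → p < L × p ≢ j × p ≢ k × at cy p ≡ v
    ordinary-position v ¬special with onCycle v in on
    ... | false with i , refl ← exhaustive v on =
      contradiction (i ↑ˡ 2 , cong [ vertex , chordEnd ]′ (sym (splitAt-↑ˡ q i 2))) ¬special
    ... | true =
      pos cy v , pos< cy v on
      , (λ p≡j → ¬special (q ↑ʳ 0F , trans (sym (at-pos cy v on)) (trans (cong (at cy) p≡j) (right 0F))))
      , (λ p≡k → ¬special (q ↑ʳ 1F , trans (sym (at-pos cy v on)) (trans (cong (at cy) p≡k) (right 1F))))
      , at-pos cy v on
      where
      right : ∀ e → chordEnd e ≡ special (q ↑ʳ e)
      right e = cong [ vertex , chordEnd ]′ (sym (splitAt-↑ʳ q 2 e))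

  module _ (σ : Fin (q + 2) → Fin (q + 2)) (σ-involutive : ∀ a → σ (σ a) ≡ a)
           (σ-adjacent : ∀ a → Adj G (special a) (special (σ a))) where

    private
      special? : ∀ v → Dec (SpecialVertex v)
      special? v = any? λ a → v ≟ᶠ special a

      special-or-not : ∀ v → SpecialVertex v ⊎ ¬ SpecialVertex v
      special-or-not v with special? v
      ... | yes s = inj₁ s
      ... | no ¬s = inj₂ ¬s

      match : Fin n → Fin n
      match v with special? v
      ... | yes (a , _) = special (σ a)
      ... | no _        = at cy (partner (pos cy v))

      match-special : ∀ a → match (special a) ≡ special (σ a)
      match-special a with special? (special a)
      ... | yes (b , e) = cong (special ∘ σ) (special-injective (sym e))
      ... | no ¬special = contradiction (a , refl) ¬special

      match-at : ∀ p → p < L → p ≢ j → p ≢ k → match (at cy p) ≡ at cy (partner p)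
      match-at p p<L p≢j p≢k with special? (at cy p)
      ... | yes (a , e) = contradiction e (at-not-special p p<L p≢j p≢k a)
      ... | no _        = cong (at cy ∘ partner) (pos-at cy p p<L)

      match-up : ∀ {p} → p < L → p ≢ j → p ≢ k → pairsUp p ≡ true → match (at cy p) ≡ at cy (suc p)
      match-up {p} p<L p≢j p≢k ↑p = trans (match-at p p<L p≢j p≢k) (cong (at cy) (partner-up {p} ↑p))

      match-down : ∀ {q} → suc q < L → suc q ≢ j → suc q ≢ k → pairsUp (suc q) ≡ false
        → match (at cy (suc q)) ≡ at cy q
      match-down {q} sq<L sq≢j sq≢k ↓sq =
        trans (match-at (suc q) sq<L sq≢j sq≢k) (cong (at cy) (partner-down {suc q} ↓sq))

      match-involutive-at : ∀ p → p < L → p ≢ j → p ≢ k → match (match (at cy p)) ≡ at cy p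
      match-involutive-at p p<L p≢j p≢k with paired p p<L p≢j p≢k
      ... | up ↑p sp<L sp≢j sp≢k ↓sp =
        trans (cong match (match-up p<L p≢j p≢k ↑p)) (match-down sp<L sp≢j sp≢k ↓sp)
      ... | down {q} ↓p q≢j q≢k ↑q =
        trans (cong match (match-down p<L p≢j p≢k ↓p)) (match-up (<-trans (n<1+n q) p<L) q≢j q≢k ↑q)

      match-adjacent-at : ∀ p → p < L → p ≢ j → p ≢ k → Adj G (at cy p) (match (at cy p))
      match-adjacent-at p p<L p≢j p≢k with paired p p<L p≢j p≢k
      ... | up ↑p sp<L _ _ _ = subst (Adj G (at cy p)) (sym (match-up p<L p≢j p≢k ↑p)) (path p sp<L)
      ... | down {q} ↓p _ _ _ =
        subst (Adj G (at cy (suc q))) (sym (match-down p<L p≢j p≢k ↓p)) (Adj-sym {G = G} (path q p<L))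

    extend : HasPM G
    extend = match , involutive , adjacent
      where
      involutive : ∀ v → match (match v) ≡ v
      involutive v with special-or-not v
      ... | inj₁ (a , refl) =
        trans (cong match (match-special a)) (trans (match-special (σ a)) (cong special (σ-involutive a)))
      ... | inj₂ ¬special with p , p<L , p≢j , p≢k , refl ← ordinary-position v ¬special =
        match-involutive-at p p<L p≢j p≢k
      adjacent : ∀ v → Adj G v (match v)
      adjacent v with special-or-not v
      ... | inj₁ (a , refl) = subst (Adj G (special a)) (sym (match-special a)) (σ-adjacent a)
      ... | inj₂ ¬special with p , p<L , p≢j , p≢k , refl ← ordinary-position v ¬special =
        match-adjacent-at p p<L p≢j p≢k

reindex : ∀ {n} {onCycle : Fin n → Bool} {q} (π : Fin q → Fin q) → (∀ i → π (π i) ≡ i)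
  → OffCycleListing onCycle q → OffCycleListing onCycle q
reindex π π-involutive out = record
  { vertex     = vertex ∘ π
  ; injective  = λ {a} {b} e → trans (sym (π-involutive a)) (trans (cong π (injective e)) (π-involutive b))
  ; off        = off ∘ π
  ; exhaustive = λ v v-off → let i , e = exhaustive v v-off in π i , trans (cong vertex (π-involutive i)) e
  }
  where open OffCycleListing out

-- The triangle and the isolated vertex

-- Listed in the order w₁ w₂ w₃ w₄, where w₁ w₂ w₃ span the triangle and w₄ is the isolated vertex.
Frame : ∀ {n} → (Fin n → Bool) → Set
Frame onCycle = OffCycleListing onCycle 4

module FrameFacts {n} {onCycle : Fin n → Bool} (F : Frame onCycle) where

  open OffCycleListing F

  w₁ w₂ w₃ w₄ : Fin n
  w₁ = vertex 0F
  w₂ = vertex 1F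
  w₃ = vertex 2F
  w₄ = vertex 3F

  w₁≢w₂ : w₁ ≢ w₂
  w₁≢w₂ = (λ ()) ∘ injective

  w₁≢w₃ : w₁ ≢ w₃
  w₁≢w₃ = (λ ()) ∘ injective

  w₂≢w₃ : w₂ ≢ w₃
  w₂≢w₃ = (λ ()) ∘ injective

  InTriangle : Fin n → Set
  InTriangle v = v ≡ w₁ ⊎ v ≡ w₂ ⊎ v ≡ w₃

  Outside : Fin n → Set
  Outside v = v ≡ w₄ ⊎ onCycle v ≡ true

  InTriangle⇒≢w₄ : ∀ {v} → InTriangle v → v ≢ w₄
  InTriangle⇒≢w₄ (inj₁ refl)        = (λ ()) ∘ injective
  InTriangle⇒≢w₄ (inj₂ (inj₁ refl)) = (λ ()) ∘ injective
  InTriangle⇒≢w₄ (inj₂ (inj₂ refl)) = (λ ()) ∘ injective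

  on≢off : ∀ {v} i → onCycle v ≡ true → v ≢ vertex i
  on≢off i on refl = contradiction (trans (sym on) (off i)) λ ()

  on⇒¬InTriangle : ∀ {v} → onCycle v ≡ true → ¬ InTriangle v
  on⇒¬InTriangle on (inj₁ e)        = on≢off 0F on e
  on⇒¬InTriangle on (inj₂ (inj₁ e)) = on≢off 1F on e
  on⇒¬InTriangle on (inj₂ (inj₂ e)) = on≢off 2F on e

  on⇒≢w₄ : ∀ {v} → onCycle v ≡ true → v ≢ w₄
  on⇒≢w₄ = on≢off 3F

  Outside⇒¬InTriangle : ∀ {v} → Outside v → ¬ InTriangle v
  Outside⇒¬InTriangle (inj₁ refl) t = InTriangle⇒≢w₄ t refl
  Outside⇒¬InTriangle (inj₂ on)   t = on⇒¬InTriangle on t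

  Outside-≢ : ∀ {x y} → Outside x → InTriangle y → x ≢ y
  Outside-≢ x-out y∈ refl = Outside⇒¬InTriangle x-out y∈

  data Kind (v : Fin n) : Set where
    triangle : InTriangle v → Kind v
    fourth   : v ≡ w₄ → Kind v
    cycle    : onCycle v ≡ true → Kind v

  kind : ∀ v → Kind v
  kind v with onCycle v in on
  ... | true = cycle on
  ... | false with exhaustive v on
  ...   | 0F , refl = triangle (inj₁ refl)
  ...   | 1F , refl = triangle (inj₂ (inj₁ refl))
  ...   | 2F , refl = triangle (inj₂ (inj₂ refl))
  ...   | 3F , refl = fourth refl

  inTriangle-or-outside : ∀ v → InTriangle v ⊎ Outside v
  inTriangle-or-outside v with kind v
  ... | triangle t = inj₁ t
  ... | fourth e   = inj₂ (inj₁ e)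
  ... | cycle on   = inj₂ (inj₂ on)

  Triangle : Graph n → Set
  Triangle G = Adj G w₁ w₂ × Adj G w₂ w₃ × Adj G w₁ w₃

  Triangle-addEdge : ∀ {G u v} → Triangle G → Triangle (addEdge G u v)
  Triangle-addEdge {G} (a , b , c) = addEdge-⊇ {G = G} a , addEdge-⊇ {G = G} b , addEdge-⊇ {G = G} c

  triangle-adjacent : ∀ {G u v} → Triangle G → InTriangle u → InTriangle v → u ≢ v → Adj G u v
  triangle-adjacent {G} (a , b , c) = λ
    { (inj₁ refl)        (inj₁ refl)        u≢v → contradiction refl u≢v
    ; (inj₁ refl)        (inj₂ (inj₁ refl)) _   → a
    ; (inj₁ refl)        (inj₂ (inj₂ refl)) _   → c
    ; (inj₂ (inj₁ refl)) (inj₁ refl)        _   → Adj-sym {G = G} a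
    ; (inj₂ (inj₁ refl)) (inj₂ (inj₁ refl)) u≢v → contradiction refl u≢v
    ; (inj₂ (inj₁ refl)) (inj₂ (inj₂ refl)) _   → b
    ; (inj₂ (inj₂ refl)) (inj₁ refl)        _   → Adj-sym {G = G} c
    ; (inj₂ (inj₂ refl)) (inj₂ (inj₁ refl)) _   → Adj-sym {G = G} b
    ; (inj₂ (inj₂ refl)) (inj₂ (inj₂ refl)) u≢v → contradiction refl u≢v
    }

  TriangleSealed : Graph n → Set
  TriangleSealed G = ∀ t x → InTriangle t → Outside x → adj G t x ≡ false

  TriangleSealed-addEdge : ∀ {G u v} → TriangleSealed G
    → (InTriangle u → ¬ Outside v) → (InTriangle v → ¬ Outside u) → TriangleSealed (addEdge G u v)
  TriangleSealed-addEdge {G} {u} {v} sealed u-ok v-ok t x t∈ x-out with adj (addEdge G u v) t x in tx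
  ... | false = refl
  ... | true with addEdge-⊆ {G = G} tx
  ...   | inj₁ old                  = contradiction (trans (sym (sealed t x t∈ x-out)) old) λ ()
  ...   | inj₂ (inj₁ (refl , refl)) = contradiction x-out (u-ok t∈)
  ...   | inj₂ (inj₂ (refl , refl)) = contradiction x-out (v-ok t∈)

  degree-2⇒TriangleSealed : ∀ {G} → Triangle G → degree G w₁ ≡ 2 → degree G w₂ ≡ 2 → degree G w₃ ≡ 2
    → TriangleSealed G
  degree-2⇒TriangleSealed {G} (a , b , c) deg₁ deg₂ deg₃ t x t∈ x-out with t∈
  ... | inj₁ refl        = degree-2⇒¬Adj G deg₁ a c w₂≢w₃ x
                             (Outside-≢ x-out (inj₂ (inj₁ refl))) (Outside-≢ x-out (inj₂ (inj₂ refl)))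
  ... | inj₂ (inj₁ refl) = degree-2⇒¬Adj G deg₂ (Adj-sym {G = G} a) b w₁≢w₃ x
                             (Outside-≢ x-out (inj₁ refl)) (Outside-≢ x-out (inj₂ (inj₂ refl)))
  ... | inj₂ (inj₂ refl) = degree-2⇒¬Adj G deg₃ (Adj-sym {G = G} c) (Adj-sym {G = G} b) w₁≢w₂ x
                             (Outside-≢ x-out (inj₁ refl)) (Outside-≢ x-out (inj₂ (inj₁ refl)))

  -- A perfect matching would restrict to a fixed-point-free involution of the three triangle vertices.
  TriangleSealed⇒¬HasPM : ∀ {G} → TriangleSealed G → ¬ HasPM G
  TriangleSealed⇒¬HasPM {G} sealed (m , involutive , adjacent) =
    cases (stays (inj₁ refl)) (stays (inj₂ (inj₁ refl))) (stays (inj₂ (inj₂ refl)))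
    where
    stays : ∀ {t} → InTriangle t → InTriangle (m t)
    stays {t} t∈ with inTriangle-or-outside (m t)
    ... | inj₁ mt∈    = mt∈
    ... | inj₂ mt-out = contradiction (trans (sym (sealed t (m t) t∈ mt-out)) (adjacent t)) λ ()
    moves : ∀ t → m t ≢ t
    moves t = Adj⇒≢ {G = G} (adjacent t) ∘ sym
    back : ∀ {a b} → m a ≡ b → m b ≡ a
    back {a} e = trans (cong m (sym e)) (involutive a)
    cases : InTriangle (m w₁) → InTriangle (m w₂) → InTriangle (m w₃) → ⊥
    cases (inj₁ e₁)        _                (inj₁ _)         = moves w₁ e₁
    cases (inj₁ e₁)        _                (inj₂ _)         = moves w₁ e₁
    cases (inj₂ (inj₁ e₁)) _                (inj₁ e₃)        = w₂≢w₃ (trans (sym e₁) (back e₃))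
    cases (inj₂ (inj₁ e₁)) _                (inj₂ (inj₁ e₃)) = w₁≢w₃ (trans (sym (back e₁)) (back e₃))
    cases (inj₂ (inj₁ _))  _                (inj₂ (inj₂ e₃)) = moves w₃ e₃
    cases (inj₂ (inj₂ e₁)) (inj₁ e₂)        _                = w₂≢w₃ (trans (sym (back e₂)) e₁)
    cases (inj₂ (inj₂ _))  (inj₂ (inj₁ e₂)) _                = moves w₂ e₂
    cases (inj₂ (inj₂ e₁)) (inj₂ (inj₂ e₂)) _                = w₁≢w₂ (trans (sym (back e₁)) (back e₂))

  W₄Isolated : Graph n → Set
  W₄Isolated G = ∀ x → adj G w₄ x ≡ false

  W₄Isolated-addEdge : ∀ {G u v} → W₄Isolated G → u ≢ w₄ → v ≢ w₄ → W₄Isolated (addEdge G u v)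
  W₄Isolated-addEdge {G} isolated u≢w₄ v≢w₄ x = addEdge-elsewhere {G = G} (isolated x) (u≢w₄ ∘ sym) (v≢w₄ ∘ sym)

  W₄Isolated⇒¬HasPM : ∀ {G} → W₄Isolated G → ¬ HasPM G
  W₄Isolated⇒¬HasPM isolated (m , _ , adjacent) = contradiction (trans (sym (isolated (m w₄))) (adjacent w₄)) λ ()

  sealed-saturated⇒complete : ∀ G → TriangleSealed G → Saturated G → Complete G
  sealed-saturated⇒complete G sealed saturated = saturated⇒complete G saturated λ x y x-on y-on →
    TriangleSealed⇒¬HasPM {addEdge G x y} (TriangleSealed-addEdge {G = G} {x} {y} sealed
      (λ x∈ _ → on⇒¬InTriangle x-on x∈) (λ y∈ _ → on⇒¬InTriangle y-on y∈))

  isolated-saturated⇒complete : ∀ G → W₄Isolated G → Saturated G → Complete G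
  isolated-saturated⇒complete G isolated saturated = saturated⇒complete G saturated λ x y x-on y-on →
    W₄Isolated⇒¬HasPM {addEdge G x y} (W₄Isolated-addEdge {G = G} {x} {y} isolated (on⇒≢w₄ x-on) (on⇒≢w₄ y-on))

  -- The special vertices w₁ w₂ w₃ w₄ c j c k are numbered 0 … 5.
  module Completions {L} (cy : CyclicOrder onCycle L) (G : Graph n) (path : PathIn G cy)
                     (even-L : even L ≡ true) (jk : EvenOddPair L) where

    open EvenOddPair jk
    open ExtendAlongCycle cy G path F even-L jk

    private
      matching : (σ : Fin 6 → Fin 6) → (∀ a → σ (σ a) ≡ a) → (∀ a → Adj G (special a) (special (σ a))) → HasPM G
      matching = extend

      sym′ : ∀ {x y} → Adj G x y → Adj G y x
      sym′ = Adj-sym {G = G}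

    hasPM-chord : Adj G w₁ w₄ → Adj G w₂ w₃ → Adj G (at cy j) (at cy k) → HasPM G
    hasPM-chord a b c = matching
      (λ { 0F → 3F ; 1F → 2F ; 2F → 1F ; 3F → 0F ; 4F → 5F ; 5F → 4F })
      (λ { 0F → refl ; 1F → refl ; 2F → refl ; 3F → refl ; 4F → refl ; 5F → refl })
      (λ { 0F → a ; 1F → b ; 2F → sym′ b ; 3F → sym′ a ; 4F → c ; 5F → sym′ c })

    hasPM-w₄-w₁ : Adj G w₄ (at cy j) → Adj G w₁ (at cy k) → Adj G w₂ w₃ → HasPM G
    hasPM-w₄-w₁ a b c = matching
      (λ { 0F → 5F ; 1F → 2F ; 2F → 1F ; 3F → 4F ; 4F → 3F ; 5F → 0F })
      (λ { 0F → refl ; 1F → refl ; 2F → refl ; 3F → refl ; 4F → refl ; 5F → refl })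
      (λ { 0F → b ; 1F → c ; 2F → sym′ c ; 3F → a ; 4F → sym′ a ; 5F → sym′ b })

    hasPM-w₁-w₄ : Adj G w₁ (at cy j) → Adj G w₄ (at cy k) → Adj G w₂ w₃ → HasPM G
    hasPM-w₁-w₄ a b c = matching
      (λ { 0F → 4F ; 1F → 2F ; 2F → 1F ; 3F → 5F ; 4F → 0F ; 5F → 3F })
      (λ { 0F → refl ; 1F → refl ; 2F → refl ; 3F → refl ; 4F → refl ; 5F → refl })
      (λ { 0F → a ; 1F → c ; 2F → sym′ c ; 3F → b ; 4F → sym′ a ; 5F → sym′ b })

    hasPM-w₁-w₂ : Adj G w₁ (at cy j) → Adj G w₂ (at cy k) → Adj G w₃ w₄ → HasPM G
    hasPM-w₁-w₂ a b c = matching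
      (λ { 0F → 4F ; 1F → 5F ; 2F → 3F ; 3F → 2F ; 4F → 0F ; 5F → 1F })
      (λ { 0F → refl ; 1F → refl ; 2F → refl ; 3F → refl ; 4F → refl ; 5F → refl })
      (λ { 0F → a ; 1F → b ; 2F → c ; 3F → sym′ c ; 4F → sym′ a ; 5F → sym′ b })

swap₁₂ : ∀ {n} {onCycle : Fin n → Bool} → Frame onCycle → Frame onCycle
swap₁₂ = reindex (λ { 0F → 1F ; 1F → 0F ; i → i }) (λ { 0F → refl ; 1F → refl ; 2F → refl ; 3F → refl })

swap₁₃ : ∀ {n} {onCycle : Fin n → Bool} → Frame onCycle → Frame onCycle
swap₁₃ = reindex (λ { 0F → 2F ; 2F → 0F ; i → i }) (λ { 0F → refl ; 1F → refl ; 2F → refl ; 3F → refl })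

module _ {n} {onCycle : Fin n → Bool} {F : Frame onCycle} {G : Graph n} where

  open FrameFacts F

  Triangle-swap₁₂ : Triangle G → FrameFacts.Triangle (swap₁₂ F) G
  Triangle-swap₁₂ (a , b , c) = Adj-sym {G = G} a , c , b

  Triangle-swap₁₃ : Triangle G → FrameFacts.Triangle (swap₁₃ F) G
  Triangle-swap₁₃ (a , b , c) = Adj-sym {G = G} b , Adj-sym {G = G} a , Adj-sym {G = G} c

module Positions {L : ℕ} (even-L : even L ≡ true) (2≤L : 2 ≤ L) where

  private
    0<L : 0 < L
    0<L = <-trans (s≤s z≤n) 2≤L

    sL : suc (pred L) ≡ L
    sL = suc-pred L {{>-nonZero 0<L}}

  pred-L<L : pred L < L
  pred-L<L = subst (pred L <_) sL ≤-refl

  0<pred-L : 0 < pred L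
  0<pred-L = s≤s⁻¹ (subst (1 <_) (sym sL) 2≤L)

  odd-pred-L : even (pred L) ≡ false
  odd-pred-L = trans (sym (not-involutive _)) (cong not (trans (cong even sL) even-L))

  first-edge : EvenOddPair L
  first-edge = evenOdd 0 1 refl refl (s≤s z≤n) 2≤L

  from-0 : ∀ q → even q ≡ false → q < L → EvenOddPair L
  from-0 q odd-q q<L = evenOdd 0 q refl odd-q (odd⇒0< odd-q) q<L
    where
    odd⇒0< : ∀ {q} → even q ≡ false → 0 < q
    odd⇒0< {suc _} _ = s≤s z≤n

  to-last : ∀ q → even q ≡ true → q < L → EvenOddPair L
  to-last q even-q q<L = evenOdd q (pred L) even-q odd-pred-L
    (≤∧≢⇒< (s≤s⁻¹ (subst (q <_) (sym sL) q<L))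
           λ q≡pL → contradiction (trans (sym even-q) (trans (cong even q≡pL) odd-pred-L)) λ ())
    pred-L<L

module Attachments {n} {onCycle : Fin n → Bool} {L} (even-L : even L ≡ true) (2≤L : 2 ≤ L)
                   (cy : CyclicOrder onCycle L) (G : Graph n) (path : PathIn G cy) where

  open Positions even-L 2≤L

  private
    sym′ : ∀ {x y} → Adj G x y → Adj G y x
    sym′ = Adj-sym {G = G}

    module C (F : Frame onCycle) = FrameFacts.Completions F cy G path even-L

  triangle-w₄⇒HasPM : ∀ (F : Frame onCycle) {t} → FrameFacts.Triangle F G → FrameFacts.InTriangle F t
    → Adj G t (FrameFacts.w₄ F) → HasPM G
  triangle-w₄⇒HasPM F (a , b , c) (inj₁ refl)        tw₄ = C.hasPM-chord F first-edge tw₄ b (path 0 2≤L)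
  triangle-w₄⇒HasPM F (a , b , c) (inj₂ (inj₁ refl)) tw₄ = C.hasPM-chord (swap₁₂ F) first-edge tw₄ c (path 0 2≤L)
  triangle-w₄⇒HasPM F (a , b , c) (inj₂ (inj₂ refl)) tw₄ = C.hasPM-chord (swap₁₃ F) first-edge tw₄ (sym′ a) (path 0 2≤L)

  w₁-outside⇒HasPM : ∀ (F : Frame onCycle) {y} → let open FrameFacts F in
    Adj G w₂ w₃ → Adj G w₄ (at cy 0) → Adj G w₄ (at cy (pred L)) → Outside y → Adj G w₁ y → HasPM G
  w₁-outside⇒HasPM F w₂w₃ w₄c₀ w₄cₗ (inj₁ refl) w₁y = C.hasPM-chord F first-edge w₁y w₂w₃ (path 0 2≤L)
  w₁-outside⇒HasPM F {y} w₂w₃ w₄c₀ w₄cₗ (inj₂ on) w₁y with pos cy y | pos< cy y on | at-pos cy y on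
  ... | q | q<L | refl with even-or-odd q
  ...   | inj₂ odd  = C.hasPM-w₄-w₁ F (from-0 q odd q<L) w₄c₀ w₁y w₂w₃
  ...   | inj₁ even = C.hasPM-w₁-w₄ F (to-last q even q<L) w₁y w₄cₗ w₂w₃

  triangle-outside⇒HasPM : ∀ (F : Frame onCycle) {t y} → let open FrameFacts F in
    Triangle G → Adj G w₄ (at cy 0) → Adj G w₄ (at cy (pred L))
    → InTriangle t → Outside y → Adj G t y → HasPM G
  triangle-outside⇒HasPM F (a , b , c) w₄c₀ w₄cₗ (inj₁ refl)        = w₁-outside⇒HasPM F b w₄c₀ w₄cₗ
  triangle-outside⇒HasPM F (a , b , c) w₄c₀ w₄cₗ (inj₂ (inj₁ refl)) = w₁-outside⇒HasPM (swap₁₂ F) c w₄c₀ w₄cₗ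
  triangle-outside⇒HasPM F (a , b , c) w₄c₀ w₄cₗ (inj₂ (inj₂ refl)) = w₁-outside⇒HasPM (swap₁₃ F) (sym′ a) w₄c₀ w₄cₗ

  w₄-edge⇒HasPM : ∀ (F : Frame onCycle) {y} → let open FrameFacts F in
    Triangle G → Adj G w₁ (at cy 0) → Adj G w₂ (at cy (pred L)) → Adj G w₄ y → HasPM G
  w₄-edge⇒HasPM F {y} (a , b , c) w₁c₀ w₂cₗ w₄y with FrameFacts.kind F y
  ... | FrameFacts.triangle (inj₁ refl)        = C.hasPM-chord F first-edge (sym′ w₄y) b (path 0 2≤L)
  ... | FrameFacts.triangle (inj₂ (inj₁ refl)) = C.hasPM-chord (swap₁₂ F) first-edge (sym′ w₄y) c (path 0 2≤L)
  ... | FrameFacts.triangle (inj₂ (inj₂ refl)) =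
    C.hasPM-w₁-w₂ F (to-last 0 refl (<-trans 0<pred-L pred-L<L)) w₁c₀ w₂cₗ (sym′ w₄y)
  ... | FrameFacts.fourth refl = contradiction refl (Adj⇒≢ {G = G} w₄y)
  ... | FrameFacts.cycle on with pos cy y | pos< cy y on | at-pos cy y on
  ...   | q | q<L | refl with even-or-odd q
  ...     | inj₂ odd  = C.hasPM-w₁-w₄ F (from-0 q odd q<L) w₁c₀ w₄y b
  ...     | inj₁ even = C.hasPM-w₄-w₁ (swap₁₂ F) (to-last q even q<L) w₄y w₂cₗ c

-- Max's strategy

module Strategy {n} {onCycle : Fin n → Bool} {L} (even-L : even L ≡ true) (2≤L : 2 ≤ L)
                (k : ℕ) (count : ∀ G → Complete {onCycle = onCycle} G → k ≤ edgeCount G) where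

  open Positions even-L 2≤L

  module Completed = InvariantStrategy k (Complete {onCycle = onCycle})
    (λ G u v complete _ → Complete-addEdge {G = G} complete) (λ G complete _ → count G complete)

  module _ (F : Frame onCycle) where

    open FrameFacts F

    W₄Attached : CyclicOrder onCycle L → Graph n → Set
    W₄Attached cy G =
      TriangleSealed G × Triangle G × CycleIn G cy × Adj G w₄ (at cy 0) × Adj G w₄ (at cy (pred L))

    W₄Attached-addEdge : ∀ cy G u v → W₄Attached cy G → Legal G u v → W₄Attached cy (addEdge G u v)
    W₄Attached-addEdge cy G u v (sealed , tri , cyc , w₄c₀ , w₄cₗ) (u≢v , _ , ¬pm) =
      TriangleSealed-addEdge {G = G} {u} {v} sealed
        (λ u∈ v-out → ¬pm (attach u∈ v-out (addEdge-new {G = G} u≢v)))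
        (λ v∈ u-out → ¬pm (attach v∈ u-out (Adj-sym {G = G′} (addEdge-new {G = G} u≢v))))
      , tri′ , cyc′ , addEdge-⊇ {G = G} w₄c₀ , addEdge-⊇ {G = G} w₄cₗ
      where
      G′ : Graph n
      G′ = addEdge G u v
      tri′ : Triangle G′
      tri′ = Triangle-addEdge {G = G} tri
      cyc′ : CycleIn G′ cy
      cyc′ = CycleIn-addEdge {G = G} cy cyc
      attach : ∀ {t y} → InTriangle t → Outside y → Adj G′ t y → HasPM G′
      attach = Attachments.triangle-outside⇒HasPM even-L 2≤L cy G′ (proj₁ cyc′) F tri′
                 (addEdge-⊇ {G = G} w₄c₀) (addEdge-⊇ {G = G} w₄cₗ)

    module W₄Phase (cy : CyclicOrder onCycle L) = InvariantStrategy k (W₄Attached cy) (W₄Attached-addEdge cy)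
      (λ G (sealed , _) saturated → count G (sealed-saturated⇒complete G sealed saturated))

    W₁W₂Attached : CyclicOrder onCycle L → Graph n → Set
    W₁W₂Attached cy G =
      W₄Isolated G × Triangle G × CycleIn G cy × Adj G w₁ (at cy 0) × Adj G w₂ (at cy (pred L))

    W₁W₂Attached-addEdge : ∀ cy G u v → W₁W₂Attached cy G → Legal G u v → W₁W₂Attached cy (addEdge G u v)
    W₁W₂Attached-addEdge cy G u v (isolated , tri , cyc , w₁c₀ , w₂cₗ) (u≢v , _ , ¬pm) =
      W₄Isolated-addEdge {G = G} {u} {v} isolated
        (λ { refl → ¬pm (attach (addEdge-new {G = G} u≢v)) })
        (λ { refl → ¬pm (attach (Adj-sym {G = G′} (addEdge-new {G = G} u≢v))) })
      , tri′ , cyc′ , addEdge-⊇ {G = G} w₁c₀ , addEdge-⊇ {G = G} w₂cₗ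
      where
      G′ : Graph n
      G′ = addEdge G u v
      tri′ : Triangle G′
      tri′ = Triangle-addEdge {G = G} tri
      cyc′ : CycleIn G′ cy
      cyc′ = CycleIn-addEdge {G = G} cy cyc
      attach : ∀ {y} → Adj G′ w₄ y → HasPM G′
      attach = Attachments.w₄-edge⇒HasPM even-L 2≤L cy G′ (proj₁ cyc′) F tri′
                 (addEdge-⊇ {G = G} w₁c₀) (addEdge-⊇ {G = G} w₂cₗ)

    module W₁W₂Phase (cy : CyclicOrder onCycle L) = InvariantStrategy k (W₁W₂Attached cy) (W₁W₂Attached-addEdge cy)
      (λ G (isolated , _) saturated → count G (isolated-saturated⇒complete G isolated saturated))

    -- Max answers Mini's edge from w₄ (or from w₁) to z by joining w₄ (or w₂) to the cycle
    -- neighbour x of z, after rotating the cycle so that z and x sit at positions 0 and L − 1.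
    module Reply (cy : CyclicOrder onCycle L) (z : Fin n) (z-on : onCycle z ≡ true) where

      open Rotation cy (pos cy z) (pos< cy z z-on)

      x : Fin n
      x = at rotate (pred L)

      x-on : onCycle x ≡ true
      x-on = at-on rotate (pred L) pred-L<L

      c₀≡z : at rotate 0 ≡ z
      c₀≡z = trans rotate-at-0 (at-pos cy z z-on)

      x≢z : x ≢ z
      x≢z e = <⇒≢ 0<pred-L (sym (at-injective rotate pred-L<L (<-trans 0<pred-L pred-L<L) (trans e (sym c₀≡z))))

      w₄-reply : ∀ G → TriangleSealed G → Triangle G → CycleIn G cy → Adj G w₄ z
        → (∀ y → Adj G w₄ y → y ≡ z) → MaxForcesMax k G
      w₄-reply G sealed tri cyc w₄z w₄-only =
        maxMove w₄ x (w₄≢x , w₄x-absent , TriangleSealed⇒¬HasPM {addEdge G w₄ x} sealed′)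
          (W₄Phase.maxForcesMini rotate (addEdge G w₄ x)
        ( sealed′ , Triangle-addEdge {G = G} tri , rotate-CycleIn {addEdge G w₄ x} (CycleIn-addEdge {G = G} cy cyc)
        , addEdge-⊇ {G = G} (subst (Adj G w₄) (sym c₀≡z) w₄z) , addEdge-new {G = G} w₄≢x ))
        where
        w₄≢x : w₄ ≢ x
        w₄≢x = on⇒≢w₄ x-on ∘ sym
        w₄x-absent : adj G w₄ x ≡ false
        w₄x-absent = ¬Adj⇒adj≡false G (x≢z ∘ w₄-only x)
        sealed′ : TriangleSealed (addEdge G w₄ x)
        sealed′ = TriangleSealed-addEdge {G = G} {w₄} {x} sealed
          (λ w₄∈ _ → InTriangle⇒≢w₄ w₄∈ refl) (λ x∈ _ → on⇒¬InTriangle x-on x∈)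

      w₁-reply : ∀ G → W₄Isolated G → Triangle G → CycleIn G cy → Adj G w₁ z
        → (∀ y → Outside y → adj G w₂ y ≡ false) → MaxForcesMax k G
      w₁-reply G isolated tri cyc w₁z w₂-quiet =
        maxMove w₂ x (w₂≢x , w₂-quiet x (inj₂ x-on) , W₄Isolated⇒¬HasPM {addEdge G w₂ x} isolated′)
          (W₁W₂Phase.maxForcesMini rotate (addEdge G w₂ x)
        ( isolated′ , Triangle-addEdge {G = G} tri , rotate-CycleIn {addEdge G w₂ x} (CycleIn-addEdge {G = G} cy cyc)
        , addEdge-⊇ {G = G} (subst (Adj G w₁) (sym c₀≡z) w₁z) , addEdge-new {G = G} w₂≢x ))
        where
        w₂≢x : w₂ ≢ x
        w₂≢x = on≢off 1F x-on ∘ sym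
        isolated′ : W₄Isolated (addEdge G w₂ x)
        isolated′ = W₄Isolated-addEdge {G = G} {w₂} {x} isolated (InTriangle⇒≢w₄ (inj₂ (inj₁ refl))) (on⇒≢w₄ x-on)

  module _ (F : Frame onCycle) (cy : CyclicOrder onCycle L) where

    open FrameFacts F

    Opening : Graph n → Set
    Opening G = TriangleSealed G × W₄Isolated G × Triangle G × CycleIn G cy

    Opening-addEdge : ∀ {G u v} → Opening G → onCycle u ≡ true → onCycle v ≡ true → Opening (addEdge G u v)
    Opening-addEdge {G} {u} {v} (sealed , isolated , tri , cyc) u-on v-on =
        TriangleSealed-addEdge {G = G} {u} {v} sealed
          (λ u∈ _ → on⇒¬InTriangle u-on u∈) (λ v∈ _ → on⇒¬InTriangle v-on v∈)
      , W₄Isolated-addEdge {G = G} {u} {v} isolated (on⇒≢w₄ u-on) (on⇒≢w₄ v-on)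
      , Triangle-addEdge {G = G} tri , CycleIn-addEdge {G = G} cy cyc

    triangle-reply : ∀ G {t} z → InTriangle t → onCycle z ≡ true → W₄Isolated G → Triangle G → CycleIn G cy
      → Adj G t z → (∀ s → InTriangle s → s ≢ t → ∀ y → Outside y → adj G s y ≡ false) → MaxForcesMax k G
    triangle-reply G z (inj₁ refl) z-on isolated tri cyc tz quiet =
      Reply.w₁-reply F cy z z-on G isolated tri cyc tz (quiet w₂ (inj₂ (inj₁ refl)) (w₁≢w₂ ∘ sym))
    triangle-reply G z (inj₂ (inj₁ refl)) z-on isolated tri cyc tz quiet =
      Reply.w₁-reply (swap₁₂ F) cy z z-on G isolated (Triangle-swap₁₂ {F = F} {G = G} tri) cyc tz
        (quiet w₁ (inj₁ refl) w₁≢w₂)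
    triangle-reply G z (inj₂ (inj₂ refl)) z-on isolated tri cyc tz quiet =
      Reply.w₁-reply (swap₁₃ F) cy z z-on G isolated (Triangle-swap₁₃ {F = F} {G = G} tri) cyc tz
        (quiet w₂ (inj₂ (inj₁ refl)) w₂≢w₃)

    private
      w₄-neighbours : ∀ {G u v y} → W₄Isolated G → Adj (addEdge G u v) w₄ y → (w₄ ≡ u × y ≡ v) ⊎ (w₄ ≡ v × y ≡ u)
      w₄-neighbours {G} {y = y} isolated w₄y with addEdge-⊆ {G = G} w₄y
      ... | inj₁ old = contradiction (trans (sym (isolated y)) old) λ ()
      ... | inj₂ new = new

    opening : ∀ fuel G → nonEdgeCount G < fuel → Opening G → MaxForcesMini k G
    opening (suc fuel) G bound state@(sealed , isolated , tri , cyc) =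
      miniTurn (λ saturated → count G (isolated-saturated⇒complete G isolated saturated)) reply
      where
      reply : ∀ u v → Legal G u v → MaxForcesMax k (addEdge G u v)
      reply u v legal@(u≢v , uv-absent , ¬pm) with kind u | kind v
      ... | cycle u-on | cycle v-on with complete-or-missing (addEdge G u v)
      ...   | inj₁ complete = Completed.maxForcesMax _ complete
      ...   | inj₂ (x , y , x-on , y-on , x≢y , xy-absent) =
        maxMove x y legal′ (opening fuel G″ bound′ state″)
        where
        G′ G″ : Graph n
        G′ = addEdge G u v
        G″ = addEdge G′ x y
        state″ : Opening G″
        state″ = Opening-addEdge {G′} {x} {y} (Opening-addEdge {G} {u} {v} state u-on v-on) x-on y-on
        legal′ : Legal G′ x y
        legal′ = x≢y , xy-absent , W₄Isolated⇒¬HasPM {G″} (proj₁ (proj₂ state″))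
        bound′ : nonEdgeCount G″ < fuel
        bound′ = <-≤-trans (<-trans (nonEdgeCount-< G′ x y legal′) (nonEdgeCount-< G u v legal)) (s≤s⁻¹ bound)
      reply u v legal@(u≢v , uv-absent , ¬pm) | fourth refl | cycle v-on =
        Reply.w₄-reply F cy v v-on (addEdge G w₄ v) sealed′
          (Triangle-addEdge {G = G} tri) (CycleIn-addEdge {G = G} cy cyc)
          (addEdge-new {G = G} u≢v) only
        where
        sealed′ = TriangleSealed-addEdge {G = G} {w₄} {v} sealed
          (λ w₄∈ _ → InTriangle⇒≢w₄ w₄∈ refl) (λ v∈ _ → on⇒¬InTriangle v-on v∈)
        only : ∀ y → Adj (addEdge G w₄ v) w₄ y → y ≡ v
        only y w₄y with w₄-neighbours {G} isolated w₄y
        ... | inj₁ (_ , y≡v)  = y≡v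
        ... | inj₂ (w₄≡v , _) = contradiction (sym w₄≡v) (on⇒≢w₄ v-on)
      reply u v legal@(u≢v , uv-absent , ¬pm) | cycle u-on | fourth refl =
        Reply.w₄-reply F cy u u-on (addEdge G u w₄) sealed′
          (Triangle-addEdge {G = G} tri) (CycleIn-addEdge {G = G} cy cyc)
          (Adj-sym {G = addEdge G u w₄} (addEdge-new {G = G} u≢v)) only
        where
        sealed′ = TriangleSealed-addEdge {G = G} {u} {w₄} sealed
          (λ u∈ _ → on⇒¬InTriangle u-on u∈) (λ w₄∈ _ → InTriangle⇒≢w₄ w₄∈ refl)
        only : ∀ y → Adj (addEdge G u w₄) w₄ y → y ≡ u
        only y w₄y with w₄-neighbours {G} isolated w₄y
        ... | inj₁ (w₄≡u , _) = contradiction (sym w₄≡u) (on⇒≢w₄ u-on)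
        ... | inj₂ (_ , y≡u)  = y≡u
      reply u v legal@(u≢v , uv-absent , ¬pm) | triangle u∈ | cycle v-on =
        triangle-reply (addEdge G u v) v u∈ v-on
          (W₄Isolated-addEdge {G = G} {u} {v} isolated (InTriangle⇒≢w₄ u∈) (on⇒≢w₄ v-on))
          (Triangle-addEdge {G = G} tri) (CycleIn-addEdge {G = G} cy cyc) (addEdge-new {G = G} u≢v)
          λ s s∈ s≢u y y-out → addEdge-elsewhere {G = G} (sealed s y s∈ y-out) s≢u
                                 (λ s≡v → on⇒¬InTriangle v-on (subst InTriangle s≡v s∈))
      reply u v legal@(u≢v , uv-absent , ¬pm) | cycle u-on | triangle v∈ =
        triangle-reply (addEdge G u v) u v∈ u-on
          (W₄Isolated-addEdge {G = G} {u} {v} isolated (on⇒≢w₄ u-on) (InTriangle⇒≢w₄ v∈))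
          (Triangle-addEdge {G = G} tri) (CycleIn-addEdge {G = G} cy cyc)
          (Adj-sym {G = addEdge G u v} (addEdge-new {G = G} u≢v))
          λ s s∈ s≢v y y-out → addEdge-elsewhere {G = G} (sealed s y s∈ y-out)
                                 (λ s≡u → on⇒¬InTriangle u-on (subst InTriangle s≡u s∈)) s≢v
      reply u v legal@(u≢v , uv-absent , ¬pm) | fourth refl | triangle v∈ =
        contradiction (triangle-w₄ v∈ (Adj-sym {G = addEdge G w₄ v} (addEdge-new {G = G} u≢v))) ¬pm
        where
        triangle-w₄ : ∀ {t} → InTriangle t → Adj (addEdge G w₄ v) t w₄ → HasPM (addEdge G w₄ v)
        triangle-w₄ = Attachments.triangle-w₄⇒HasPM even-L 2≤L cy (addEdge G w₄ v)
                        (proj₁ (CycleIn-addEdge {G = G} cy cyc)) F (Triangle-addEdge {G = G} tri)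
      reply u v legal@(u≢v , uv-absent , ¬pm) | triangle u∈ | fourth refl =
        contradiction (triangle-w₄ u∈ (addEdge-new {G = G} u≢v)) ¬pm
        where
        triangle-w₄ : ∀ {t} → InTriangle t → Adj (addEdge G u w₄) t w₄ → HasPM (addEdge G u w₄)
        triangle-w₄ = Attachments.triangle-w₄⇒HasPM even-L 2≤L cy (addEdge G u w₄)
                        (proj₁ (CycleIn-addEdge {G = G} cy cyc)) F (Triangle-addEdge {G = G} tri)
      reply u v legal@(u≢v , uv-absent , ¬pm) | triangle u∈ | triangle v∈ =
        contradiction (trans (sym uv-absent) (triangle-adjacent {G} tri u∈ v∈ u≢v)) λ ()
      reply u v legal@(u≢v , uv-absent , ¬pm) | fourth refl | fourth refl = contradiction refl u≢v

    maxForcesMini-opening : ∀ G → Opening G → MaxForcesMini k G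
    maxForcesMini-opening G = opening (suc (nonEdgeCount G)) G ≤-refl

even-*2 : ∀ q → even (q * 2) ≡ true
even-*2 zero    = refl
even-*2 (suc q) = trans (not-involutive (even (q * 2))) (even-*2 q)

module _ {n} {onCycle : Fin n → Bool} {m} (c : Fin (suc m) → Fin n) (c-injective : ∀ i j → c i ≡ c j → i ≡ j)
         (c-onto : ∀ v → (onCycle v ≡ true) ⇔ ∃ λ i → c i ≡ v) where

  private
    L : ℕ
    L = suc m

    at′ : ℕ → Fin n
    at′ p with p <? L
    ... | yes p<L = c (fromℕ< p<L)
    ... | no _    = c zero

    at′-toℕ : ∀ {p} i → toℕ i ≡ p → at′ p ≡ c i
    at′-toℕ {p} i e with p <? L
    ... | yes p<L = cong c (toℕ-injective (trans (toℕ-fromℕ< p<L) (sym e)))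
    ... | no ¬p<L = contradiction (subst (_< L) e (toℕ<n i)) ¬p<L

    pos′ : Fin n → ℕ
    pos′ v with onCycle v ≟ᵇ true
    ... | yes on = toℕ (proj₁ (Equivalence.to (c-onto v) on))
    ... | no _   = 0

    pos′-spec : ∀ v → onCycle v ≡ true → ∃ λ i → c i ≡ v × pos′ v ≡ toℕ i
    pos′-spec v on with onCycle v ≟ᵇ true
    ... | yes on′ = let i , e = Equivalence.to (c-onto v) on′ in i , e , refl
    ... | no ¬on  = contradiction on ¬on

    at′-on : ∀ p → p < L → onCycle (at′ p) ≡ true
    at′-on p p<L = subst (λ v → onCycle v ≡ true) (sym (at′-toℕ (fromℕ< p<L) (toℕ-fromℕ< p<L)))
                     (Equivalence.from (c-onto _) (_ , refl))

    pos′-at′ : ∀ p → p < L → pos′ (at′ p) ≡ p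
    pos′-at′ p p<L with i , cᵢ≡ , pos≡ ← pos′-spec (at′ p) (at′-on p p<L) =
      trans pos≡ (trans (cong toℕ (c-injective i (fromℕ< p<L) (trans cᵢ≡ (at′-toℕ _ (toℕ-fromℕ< p<L)))))
                        (toℕ-fromℕ< p<L))

    pos′< : ∀ v → onCycle v ≡ true → pos′ v < L
    pos′< v on with i , _ , pos≡ ← pos′-spec v on = subst (_< L) (sym pos≡) (toℕ<n i)

    at′-pos′ : ∀ v → onCycle v ≡ true → at′ (pos′ v) ≡ v
    at′-pos′ v on with i , cᵢ≡ , pos≡ ← pos′-spec v on = trans (at′-toℕ i (sym pos≡)) cᵢ≡

  enumeration⇒CyclicOrder : CyclicOrder onCycle L
  enumeration⇒CyclicOrder = record
    { at = at′ ; pos = pos′ ; at-on = at′-on ; pos-at = pos′-at′ ; pos< = pos′< ; at-pos = at′-pos′ }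

  enumeration-CycleIn : ∀ G → (∀ (i : Fin m) → Adj G (c (inject₁ i)) (c (suc i))) → Adj G (c (fromℕ m)) (c zero)
    → CycleIn G enumeration⇒CyclicOrder
  enumeration-CycleIn G steps closing = path , closing′
    where
    path : PathIn G enumeration⇒CyclicOrder
    path p sp<L = subst₂ (Adj G) (sym (at′-toℕ (inject₁ i) (trans (toℕ-inject₁ i) (toℕ-fromℕ< p<m))))
                    (sym (at′-toℕ (suc i) (cong suc (toℕ-fromℕ< p<m)))) (steps i)
      where
      p<m : p < m
      p<m = s≤s⁻¹ sp<L
      i : Fin m
      i = fromℕ< p<m
    closing′ : Adj G (at′ m) (at′ 0)
    closing′ = subst₂ (Adj G) (sym (at′-toℕ (fromℕ m) (toℕ-fromℕ m))) (sym (at′-toℕ zero refl)) closing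

listing+enumeration⇒size : ∀ {n} {onCycle : Fin n → Bool} {q L} → OffCycleListing onCycle q
  → (c : Fin L → Fin n) → (∀ i j → c i ≡ c j → i ≡ j) → (∀ v → (onCycle v ≡ true) ⇔ ∃ λ i → c i ≡ v)
  → n ≡ q + L
listing+enumeration⇒size {n} {onCycle} {q} {L} out c c-injective c-onto =
  ≤-antisym (surjective⇒≤ enumerate onto) (injective⇒≤ {f = enumerate} enumerate-injective)
  where
  open OffCycleListing out
  enumerate : Fin (q + L) → Fin n
  enumerate = [ vertex , c ]′ ∘ splitAt q
  c-on : ∀ j → onCycle (c j) ≡ true
  c-on j = Equivalence.from (c-onto (c j)) (j , refl)
  enumerate-injective : ∀ {a b} → enumerate a ≡ enumerate b → a ≡ b
  enumerate-injective = [,]∘splitAt-injective vertex c injective (c-injective _ _)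
    λ i j e → contradiction (trans (sym (off i)) (subst (λ v → onCycle v ≡ true) (sym e) (c-on j))) λ ()
  onto : ∀ v → ∃ λ a → enumerate a ≡ v
  onto v with onCycle v in on
  ... | true  = let j , e = Equivalence.to (c-onto v) on in
                q ↑ʳ j , trans (cong [ vertex , c ]′ (splitAt-↑ʳ q L j)) e
  ... | false = let i , e = exhaustive v on in
                i ↑ˡ L , trans (cong [ vertex , c ]′ (splitAt-↑ˡ q i L)) e

complete⇒C2≤edgeCount : ∀ {n} {onCycle : Fin n → Bool} {L} (cy : CyclicOrder onCycle L) (G : Graph n)
  → Complete {onCycle = onCycle} G → L C 2 ≤ edgeCount G
complete⇒C2≤edgeCount {L = L} cy G complete = clique⇒C2≤edgeCount G L (at cy) (at-injective cy)
  λ {p} {q} p<q q<L → complete _ _ (at-on cy p (<-trans p<q q<L)) (at-on cy q q<L)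
                        λ e → <⇒≢ p<q (at-injective cy (<-trans p<q q<L) q<L e)

module Deletion {n} (w₁ w₂ w₃ w₄ : Fin n) where

  kept : Fin n → Bool
  kept x = not (x == w₁ ∨ x == w₂ ∨ x == w₃ ∨ x == w₄)

  Deleted : Fin n → Set
  Deleted v = v ≡ w₁ ⊎ v ≡ w₂ ⊎ v ≡ w₃ ⊎ v ≡ w₄

  deleted⇒¬kept : ∀ {v} → Deleted v → kept v ≡ false
  deleted⇒¬kept {v} v∈ with v ≟ᶠ w₁ | v ≟ᶠ w₂ | v ≟ᶠ w₃ | v ≟ᶠ w₄
  ... | yes _ | _     | _     | _     = refl
  ... | no _  | yes _ | _     | _     = refl
  ... | no _  | no _  | yes _ | _     = refl
  ... | no _  | no _  | no _  | yes _ = refl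
  ... | no a  | no b  | no c  | no d  = contradiction v∈ [ a , [ b , [ c , d ]′ ]′ ]′

  ¬kept⇒deleted : ∀ {v} → kept v ≡ false → Deleted v
  ¬kept⇒deleted {v} ¬kept with v ≟ᶠ w₁ | v ≟ᶠ w₂ | v ≟ᶠ w₃ | v ≟ᶠ w₄
  ... | yes e | _     | _     | _     = inj₁ e
  ... | no _  | yes e | _     | _     = inj₂ (inj₁ e)
  ... | no _  | no _  | yes e | _     = inj₂ (inj₂ (inj₁ e))
  ... | no _  | no _  | no _  | yes e = inj₂ (inj₂ (inj₂ e))
  ... | no _  | no _  | no _  | no _  = contradiction ¬kept λ ()

  deletedFrame : w₁ ≢ w₂ → w₁ ≢ w₃ → w₁ ≢ w₄ → w₂ ≢ w₃ → w₂ ≢ w₄ → w₃ ≢ w₄ → Frame kept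
  deletedFrame w₁≢w₂ w₁≢w₃ w₁≢w₄ w₂≢w₃ w₂≢w₄ w₃≢w₄ = record
    { vertex     = lookup ws
    ; injective  = lookup-injective distinct _ _
    ; off        = λ i → deleted⇒¬kept (lookup-deleted i)
    ; exhaustive = λ v → listed ∘ ¬kept⇒deleted
    }
    where
    ws : Vec (Fin n) 4
    ws = w₁ ∷ w₂ ∷ w₃ ∷ w₄ ∷ []
    distinct : UniqueVec ws
    distinct = (w₁≢w₂ ∷ w₁≢w₃ ∷ w₁≢w₄ ∷ []) ∷ (w₂≢w₃ ∷ w₂≢w₄ ∷ []) ∷ (w₃≢w₄ ∷ []) ∷ [] ∷ []
    lookup-deleted : ∀ i → Deleted (lookup ws i)
    lookup-deleted 0F = inj₁ refl
    lookup-deleted 1F = inj₂ (inj₁ refl)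
    lookup-deleted 2F = inj₂ (inj₂ (inj₁ refl))
    lookup-deleted 3F = inj₂ (inj₂ (inj₂ refl))
    listed : ∀ {v} → Deleted v → ∃ λ i → lookup ws i ≡ v
    listed (inj₁ refl)               = 0F , refl
    listed (inj₂ (inj₁ refl))        = 1F , refl
    listed (inj₂ (inj₂ (inj₁ refl))) = 2F , refl
    listed (inj₂ (inj₂ (inj₂ refl))) = 3F , refl

even-4+ : ∀ x → even (4 + x) ≡ even x
even-4+ x = trans (not-involutive _) (not-involutive _)

lemma4p4 : (n : ℕ) → 8 ≤ n → 2 ∣ n → (G₀ : Graph n) → (w₁ w₂ w₃ w₄ : Fin n)
    → Adj G₀ w₁ w₂ → Adj G₀ w₂ w₃ → Adj G₀ w₁ w₃
    → degree G₀ w₁ ≡ 2 → degree G₀ w₂ ≡ 2 → degree G₀ w₃ ≡ 2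
    → degree G₀ w₄ ≡ 0
    → HamiltonAfterDeleting4 G₀ w₁ w₂ w₃ w₄
    → ¬ HasPM G₀
    → MaxForcesMini ((n ∸ 4) C 2) G₀
lemma4p4 n _ (divides q n≡q*2) G₀ w₁ w₂ w₃ w₄ w₁w₂ w₂w₃ w₁w₃ deg₁ deg₂ deg₃ deg₄
         (m , c , 2≤m , c-injective , c-onto , steps , closing) _ =
  Strategy.maxForcesMini-opening even-L (≤-trans 2≤m (n≤1+n m)) ((n ∸ 4) C 2) count F cy G₀
    ( degree-2⇒TriangleSealed F {G₀} triangle deg₁ deg₂ deg₃ , isolated , triangle
    , enumeration-CycleIn c c-injective c-onto G₀ steps closing )
  where
  open FrameFacts using (degree-2⇒TriangleSealed)
  isolated : ∀ x → adj G₀ w₄ x ≡ false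
  isolated = degree-0⇒¬Adj G₀ deg₄
  ≢w₄ : ∀ {w x} → Adj G₀ w x → w ≢ w₄
  ≢w₄ {x = x} wx refl = contradiction (trans (sym (isolated x)) wx) λ ()
  F : Frame (Deletion.kept w₁ w₂ w₃ w₄)
  F = Deletion.deletedFrame w₁ w₂ w₃ w₄ (Adj⇒≢ {G = G₀} w₁w₂) (Adj⇒≢ {G = G₀} w₁w₃) (≢w₄ w₁w₂)
        (Adj⇒≢ {G = G₀} w₂w₃) (≢w₄ w₂w₃) (≢w₄ (Adj-sym {G = G₀} w₁w₃))
  triangle : FrameFacts.Triangle F G₀
  triangle = w₁w₂ , w₂w₃ , w₁w₃
  cy : CyclicOrder (Deletion.kept w₁ w₂ w₃ w₄) (suc m)
  cy = enumeration⇒CyclicOrder c c-injective c-onto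
  n≡4+L : n ≡ 4 + suc m
  n≡4+L = listing+enumeration⇒size F c c-injective c-onto
  even-L : even (suc m) ≡ true
  even-L = trans (sym (even-4+ (suc m))) (trans (cong even (sym n≡4+L)) (trans (cong even n≡q*2) (even-*2 q)))
  count : ∀ G → Complete G → (n ∸ 4) C 2 ≤ edgeCount G
  count G complete = subst (λ l → l C 2 ≤ edgeCount G) (sym (cong (_∸ 4) n≡4+L)) (complete⇒C2≤edgeCount cy G complete)
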